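{- Let $q$ be a prime power and let $\mathcal{B}$ be a $2$-blocking set of the Hermitian curve $\mathcal{H}_q$ in $\mathrm{PG}(2,q^2)$. Then in $\mathrm{PG}(2,q^2)$ there exist semiovals of size $k$ for every integer $k$ with $|\mathcal{B}|\leq k\leq q^3+1$.
   Context: $\mathrm{PG}(2,q^2)$ is the Desarguesian projective plane over $\mathbb{F}_{q^2}$. The Hermitian curve $\mathcal{H}_q$ is the set of points of $\mathrm{PG}(2,q^2)$ satisfying $X_2X_0^q+X_2^qX_0+X_1^{q+1}=0$; it has $q^3+1$ points, each of its points lies on a unique tangent line, and every other line of $\mathrm{PG}(2,q^2)$ meets $\mathcal{H}_q$ in exactly $q+1$ points (a $(q+1)$-secant). A pointset $\mathcal{D}\subseteq\mathcal{H}_q$ is a $2$-blocking set of $\mathcal{H}_q$ if every $(q+1)$-secant of $\mathcal{H}_q$ contains at least $2$ points of $\mathcal{D}$. A semioval is a non-empty pointset $\mathcal{S}$ such that for every $P\in\mathcal{S}$ there is a unique line $t_P$ with $\mathcal{S}\cap t_P=\{P\}$. -}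

module Defs where

open import Level using (0ℓ)
open import Data.Nat using (ℕ; zero; suc; _≤_) renaming (_+_ to _+ℕ_; _*_ to _*ℕ_; _^_ to _^ℕ_)
open import Data.Nat.Primality using (Prime)
open import Data.Fin using (Fin)
open import Data.Product using (Σ; ∃; _×_; _,_)
open import Data.List using (List; length)
open import Data.List.Relation.Unary.All using (All)
open import Data.List.Relation.Unary.Any using (Any)
open import Data.List.Relation.Unary.AllPairs using (AllPairs)
open import Data.List.Membership.Propositional using (_∈_)
open import Relation.Nullary using (¬_)
open import Relation.Binary.PropositionalEquality using (_≡_)
open import Algebra.Core using (Op₁; Op₂)
open import Algebra.Structures using (IsCommutativeRing)
open import Function.Bundles using (_↔_)

IsPrimePower : ℕ → Set
IsPrimePower q = Σ ℕ λ p → Σ ℕ λ e → Prime p × 1 ≤ e × q ≡ p ^ℕ e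

record FiniteField (n : ℕ) : Set₁ where
  infixl 6 _+_
  infixl 7 _*_
  field
    Carrier : Set
    _+_ _*_ : Op₂ Carrier
    -_      : Op₁ Carrier
    0# 1#   : Carrier
    isCommutativeRing : IsCommutativeRing _≡_ _+_ _*_ -_ 0# 1#
    0≢1     : ¬ (0# ≡ 1#)
    inverse : ∀ x → ¬ (x ≡ 0#) → ∃ λ y → x * y ≡ 1#
    enumeration : Carrier ↔ Fin n

module Plane {n : ℕ} (F : FiniteField n) where
  open FiniteField F

  pow : Carrier → ℕ → Carrier
  pow x zero = 1#
  pow x (suc k) = x * pow x k

  Triple : Set
  Triple = Carrier × Carrier × Carrier

  NonZero : Triple → Set
  NonZero (x , y , z) = ¬ (x ≡ 0# × y ≡ 0# × z ≡ 0#)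

  scale : Carrier → Triple → Triple
  scale c (x , y , z) = (c * x , c * y , c * z)

  -- two triples represent the same projective point (or line)
  Proportional : Triple → Triple → Set
  Proportional u v = ∃ λ c → ¬ (c ≡ 0#) × u ≡ scale c v

  _onLine_ : Triple → Triple → Set
  (x , y , z) onLine (a , b , c) = a * x + b * y + c * z ≡ 0#

  record PointSet : Set where
    constructor mkPointSet
    field
      pts      : List Triple
      nonzero  : All NonZero pts
      distinct : AllPairs (λ u v → ¬ Proportional u v) pts

  open PointSet public

  size : PointSet → ℕ
  size S = length (pts S)

  _∈ₚ_ : Triple → PointSet → Set
  P ∈ₚ S = Any (Proportional P) (pts S)

  MeetsOnlyIn : PointSet → Triple → Triple → Set
  MeetsOnlyIn S L P = P onLine L × (∀ Q → Q ∈ pts S → Q onLine L → Proportional Q P)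

  IsSemioval : PointSet → Set
  IsSemioval S =
    (1 ≤ size S) ×
    (∀ P → P ∈ pts S →
       ∃ λ t → NonZero t × MeetsOnlyIn S t P ×
         (∀ t' → NonZero t' → MeetsOnlyIn S t' P → Proportional t' t))

module Hermitian (q : ℕ) (F : FiniteField (q *ℕ q)) where
  open FiniteField F
  open Plane F public

  OnH : Triple → Set
  OnH (x0 , x1 , x2) = x2 * pow x0 q + pow x2 q * x0 + pow x1 (suc q) ≡ 0#

  IsSecant : Triple → Set
  IsSecant L = ∃ λ (S : PointSet) →
    size S ≡ suc q × All OnH (pts S) × All (_onLine L) (pts S) ×
    (∀ P → NonZero P → OnH P → P onLine L → P ∈ₚ S)

  Is2BlockingSet : PointSet → Set
  Is2BlockingSet D =
    All OnH (pts D) ×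
    (∀ L → NonZero L → IsSecant L →
       ∃ λ P → ∃ λ Q → P ∈ pts D × Q ∈ pts D × P onLine L × Q onLine L × ¬ Proportional P Q)

module Submission where

-- Let D be any set of points of the Hermitian curve containing B. At P ∈ D the tangent meets the
-- curve, hence D, only in P. Any other line through P is a (q+1)-secant: its further curve points
-- correspond to a fibre of the trace x ↦ x^q + x, and every such fibre has q elements. So that line
-- contains two points of B ⊆ D and is not a tangent of D. Hence D is a semioval, and as the curve
-- has q³ + 1 points, D can be taken of any size between |B| and q³ + 1.

open import Level using (0ℓ)
open import Data.Bool using (if_then_else_)
open import Data.Nat using (ℕ; zero; suc; _∸_; _≤_; _<_; z≤n; s≤s)
import Data.Nat as ℕ
import Data.Nat.Properties as ℕ
open import Data.Nat.Combinatorics using (_C_; nC1≡n; nCn≡1; nCk+nC[k+1]≡[n+1]C[k+1])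
open import Data.Nat.Divisibility using (_∣_; divides; ∣⇒≤)
open import Data.Nat.Primality using (Prime; euclidsLemma; ¬prime[0]; ¬prime[1])
open import Data.Nat.ListAction using (sum)
import Data.Integer as ℤ
open import Data.Integer using (ℤ; -[1+_]; 0ℤ)
import Data.Integer.Properties as ℤ
open import Data.Sign as Sign using (Sign)
open import Data.Fin using (Fin; punchIn) renaming (zero to fzero; suc to fsuc)
import Data.Fin as Fin
import Data.Fin.Properties as Fin
open import Data.Fin.Permutation using (Permutation; permutation)
open import Data.Maybe using (Maybe; just; nothing)
open import Data.Product using (Σ; ∃; _×_; _,_; proj₁; proj₂)
open import Data.Sum using (_⊎_; inj₁; inj₂; reduce)
open import Data.Empty using (⊥-elim)
open import Data.List using (List; []; _∷_; length; map; filter; allFin; take; _++_)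
import Data.List.Properties as List
open import Data.List.Relation.Unary.All using (All; []; _∷_)
import Data.List.Relation.Unary.All as All
import Data.List.Relation.Unary.All.Properties as All
open import Data.List.Relation.Unary.Any using (Any; here; there)
import Data.List.Relation.Unary.Any as Any
open import Data.List.Relation.Unary.AllPairs using (AllPairs; []; _∷_)
import Data.List.Relation.Unary.AllPairs as AllPairs
import Data.List.Relation.Unary.AllPairs.Properties as AllPairs
open import Data.List.Relation.Unary.Unique.Propositional using (Unique)
import Data.List.Relation.Unary.Unique.Propositional.Properties as Unique
open import Data.List.Membership.Propositional using (_∈_; _∉_)
import Data.List.Membership.Propositional.Properties as ∈
open import Function using (_∘_)
open import Function.Bundles using (Inverse; _↔_)
open import Relation.Nullary using (¬_; Dec; yes; no; does)
open import Relation.Nullary.Decidable using (¬?; _×-dec_)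
open import Relation.Unary using (Decidable)
import Relation.Binary as Binary
open import Relation.Binary using (Rel; Symmetric; Transitive; DecidableEquality)
open import Relation.Binary.PropositionalEquality
open import Algebra.Core using (Op₁; Op₂)
open import Algebra.Bundles using (CommutativeRing)
open import Algebra.Structures using (IsCommutativeRing)
import Algebra.Solver.Ring
import Algebra.Solver.Ring.AlmostCommutativeRing as ACR
import Algebra.Properties.CommutativeMonoid.Sum as CommutativeMonoidSum
import Algebra.Properties.CommutativeSemiring.Binomial
open import Algebra.Properties.CommutativeSemigroup ℕ.+-commutativeSemigroup using () renaming (interchange to +-interchange)
open import Defs

[1+k]*[1+n]C[1+k]≡[1+n]*nCk : ∀ n k → suc k ℕ.* (suc n C suc k) ≡ suc n ℕ.* (n C k)
[1+k]*[1+n]C[1+k]≡[1+n]*nCk zero    zero    = refl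
[1+k]*[1+n]C[1+k]≡[1+n]*nCk zero    (suc k) = ℕ.*-zeroʳ (suc (suc k))
[1+k]*[1+n]C[1+k]≡[1+n]*nCk (suc n) zero    = trans (ℕ.*-identityˡ _) (trans (nC1≡n (suc (suc n))) (sym (ℕ.*-identityʳ _)))
[1+k]*[1+n]C[1+k]≡[1+n]*nCk (suc n) (suc k) = begin
  suc (suc k) ℕ.* (suc (suc n) C suc (suc k))        ≡⟨ cong (suc (suc k) ℕ.*_) (nCk+nC[k+1]≡[n+1]C[k+1] (suc n) (suc k)) ⟨
  suc (suc k) ℕ.* (a ℕ.+ b)                          ≡⟨ ℕ.*-distribˡ-+ (suc (suc k)) a b ⟩
  (a ℕ.+ suc k ℕ.* a) ℕ.+ suc (suc k) ℕ.* b          ≡⟨ ℕ.+-assoc a (suc k ℕ.* a) _ ⟩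
  a ℕ.+ (suc k ℕ.* a ℕ.+ suc (suc k) ℕ.* b)          ≡⟨ cong₂ (λ u v → a ℕ.+ (u ℕ.+ v)) ([1+k]*[1+n]C[1+k]≡[1+n]*nCk n k)
                                                                                        ([1+k]*[1+n]C[1+k]≡[1+n]*nCk n (suc k)) ⟩
  a ℕ.+ (suc n ℕ.* (n C k) ℕ.+ suc n ℕ.* (n C suc k)) ≡⟨ cong (a ℕ.+_) (ℕ.*-distribˡ-+ (suc n) (n C k) (n C suc k)) ⟨
  a ℕ.+ suc n ℕ.* ((n C k) ℕ.+ (n C suc k))          ≡⟨ cong (λ z → a ℕ.+ suc n ℕ.* z) (nCk+nC[k+1]≡[n+1]C[k+1] n k) ⟩
  suc (suc n) ℕ.* a                                  ∎
  where
  open ≡-Reasoning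
  a b : ℕ
  a = suc n C suc k
  b = suc n C suc (suc k)

prime∣pCk : ∀ {p} → Prime p → ∀ {k} → 0 < k → k < p → p ∣ p C k
prime∣pCk {zero} p-prime _ _ = ⊥-elim (¬prime[0] p-prime)
prime∣pCk {suc n} p-prime {suc k} _ k<p
  with euclidsLemma (suc k) (suc n C suc k) p-prime
         (divides (n C k) (trans ([1+k]*[1+n]C[1+k]≡[1+n]*nCk n k) (ℕ.*-comm (suc n) (n C k))))
... | inj₁ p∣1+k   = ⊥-elim (ℕ.<⇒≱ k<p (∣⇒≤ p∣1+k))
... | inj₂ p∣pCk   = p∣pCk

sum≤length*bound : ∀ {m} ns → All (_≤ m) ns → sum ns ≤ length ns ℕ.* m
sum≤length*bound []       []          = z≤n
sum≤length*bound (n ∷ ns) (n≤m ∷ ns≤m) = ℕ.+-mono-≤ n≤m (sum≤length*bound ns ns≤m)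

all≤∧sum≥⇒all≡ : ∀ {m} ns → All (_≤ m) ns → length ns ℕ.* m ≤ sum ns → All (_≡ m) ns
all≤∧sum≥⇒all≡         []       _            _ = []
all≤∧sum≥⇒all≡ {m} (n ∷ ns) (n≤m ∷ ns≤m) ≤sum with ℕ.m≤n⇒m<n∨m≡n n≤m
... | inj₁ n<m = ⊥-elim (ℕ.<⇒≱ (ℕ.+-mono-<-≤ n<m (sum≤length*bound ns ns≤m)) ≤sum)
... | inj₂ refl = refl ∷ all≤∧sum≥⇒all≡ ns ns≤m (ℕ.+-cancelˡ-≤ m _ _ ≤sum)

sum-map-+ : ∀ {A : Set} (f g : A → ℕ) xs → sum (map (λ x → f x ℕ.+ g x) xs) ≡ sum (map f xs) ℕ.+ sum (map g xs)
sum-map-+ f g []       = refl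
sum-map-+ f g (x ∷ xs) = trans (cong (f x ℕ.+ g x ℕ.+_) (sum-map-+ f g xs))
                               (+-interchange (f x) (g x) (sum (map f xs)) (sum (map g xs)))

length-filter+length-filter-¬ : ∀ {A : Set} {P : A → Set} (P? : Decidable P) xs →
  length (filter P? xs) ℕ.+ length (filter (¬? ∘ P?) xs) ≡ length xs
length-filter+length-filter-¬ P? []       = refl
length-filter+length-filter-¬ P? (x ∷ xs) with P? x
... | yes _ = cong suc (length-filter+length-filter-¬ P? xs)
... | no  _ = trans (ℕ.+-suc _ _) (cong suc (length-filter+length-filter-¬ P? xs))

module Fibres {A B : Set} (_≟_ : DecidableEquality B) where

  fibre : (A → B) → B → List A → List A
  fibre f y = filter (λ x → f x ≟ y)

  private
    δ : B → B → ℕ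
    δ y k = if does (y ≟ k) then 1 else 0

    sum-δ-∉ : ∀ {y} ks → y ∉ ks → sum (map (δ y) ks) ≡ 0
    sum-δ-∉ {y} []       _   = refl
    sum-δ-∉ {y} (k ∷ ks) y∉ with y ≟ k
    ... | yes y≡k = ⊥-elim (y∉ (here y≡k))
    ... | no  _   = sum-δ-∉ ks (y∉ ∘ there)

    sum-δ-∈ : ∀ {y ks} → Unique ks → y ∈ ks → sum (map (δ y) ks) ≡ 1
    sum-δ-∈ {y} {k ∷ ks} (k∉ks ∷ ks!) y∈ with y ≟ k | y∈
    ... | yes refl | _        = cong suc (sum-δ-∉ ks (λ y∈ks → All.lookup k∉ks y∈ks refl))
    ... | no  y≢k  | here y≡k = ⊥-elim (y≢k y≡k)
    ... | no  _    | there y∈ks = sum-δ-∈ ks! y∈ks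

    length-fibre-∷ : ∀ f k x xs → length (fibre f k (x ∷ xs)) ≡ δ (f x) k ℕ.+ length (fibre f k xs)
    length-fibre-∷ f k x xs with f x ≟ k
    ... | yes _ = refl
    ... | no  _ = refl

    sum-map-0 : ∀ (ks : List B) → sum (map (λ _ → 0) ks) ≡ 0
    sum-map-0 []       = refl
    sum-map-0 (_ ∷ ks) = sum-map-0 ks

  sum-length-fibres : ∀ (f : A → B) {ks} → Unique ks → ∀ xs → All (λ x → f x ∈ ks) xs →
                      sum (map (λ k → length (fibre f k xs)) ks) ≡ length xs
  sum-length-fibres f {ks} ks! []       []             = sum-map-0 ks
  sum-length-fibres f {ks} ks! (x ∷ xs) (fx∈ks ∷ fxs∈ks) = begin
    sum (map (λ k → length (fibre f k (x ∷ xs))) ks)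
      ≡⟨ cong sum (List.map-cong (λ k → length-fibre-∷ f k x xs) ks) ⟩
    sum (map (λ k → δ (f x) k ℕ.+ length (fibre f k xs)) ks)
      ≡⟨ sum-map-+ (δ (f x)) (λ k → length (fibre f k xs)) ks ⟩
    sum (map (δ (f x)) ks) ℕ.+ sum (map (λ k → length (fibre f k xs)) ks)
      ≡⟨ cong₂ ℕ._+_ (sum-δ-∈ ks! fx∈ks) (sum-length-fibres f ks! xs fxs∈ks) ⟩
    suc (length xs) ∎
    where open ≡-Reasoning

module _ {A : Set} {R : Rel A 0ℓ} (R? : Binary.Decidable R) (R-sym : Symmetric R) (R-trans : Transitive R) where

  private
    length≤1 : ∀ {x} ys → AllPairs (λ a b → ¬ R a b) ys → All (λ y → R y x) ys → length ys ≤ 1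
    length≤1 []           _                   _                = z≤n
    length≤1 (_ ∷ [])     _                   _                = s≤s z≤n
    length≤1 (_ ∷ _ ∷ _) ((¬R ∷ _) ∷ _) (Ryx ∷ Ry'x ∷ _) = ⊥-elim (¬R (R-trans Ryx (R-sym Ry'x)))

  length-≤-of-covered : ∀ xs ys → AllPairs (λ a b → ¬ R a b) ys → All (λ y → Any (R y) xs) ys →
                        length ys ≤ length xs
  length-≤-of-covered []       []       _   _          = z≤n
  length-≤-of-covered []       (_ ∷ _)  _   (() ∷ _)
  length-≤-of-covered (x ∷ xs) ys       ys! ys⊆x∷xs = begin
    length ys                                          ≡⟨ length-filter+length-filter-¬ (λ y → R? y x) ys ⟨
    length (filter (λ y → R? y x) ys) ℕ.+ length others  ≤⟨ ℕ.+-mono-≤ same rest ⟩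
    1 ℕ.+ length xs                                      ∎
    where
    open ℕ.≤-Reasoning
    others : List A
    others = filter (λ y → ¬? (R? y x)) ys
    same : length (filter (λ y → R? y x) ys) ≤ 1
    same = length≤1 _ (AllPairs.filter⁺ (λ y → R? y x) ys!) (All.all-filter (λ y → R? y x) ys)
    drop-x : ∀ {y} → Any (R y) (x ∷ xs) → ¬ R y x → Any (R y) xs
    drop-x (here Ryx) ¬Ryx = ⊥-elim (¬Ryx Ryx)
    drop-x (there p)  _    = p
    rest : length others ≤ length xs
    rest = length-≤-of-covered xs others (AllPairs.filter⁺ (λ y → ¬? (R? y x)) ys!)
             (All.map (λ (p , ¬Ryx) → drop-x p ¬Ryx)
               (All.zip (All.filter⁺ (λ y → ¬? (R? y x)) ys⊆x∷xs , All.all-filter (λ y → ¬? (R? y x)) ys)))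


-- The ring solver with integer coefficients, through the canonical morphism ℤ → A. (Solving with
-- the abstract elements of A as coefficients cannot cancel x - x.)
module IntegerCoefficientSolver {A : Set} {add mul : Op₂ A} {neg : Op₁ A} {z o : A}
  (isCommutativeRing : IsCommutativeRing _≡_ add mul neg z o) where

  ring : CommutativeRing 0ℓ 0ℓ
  ring = record { isCommutativeRing = isCommutativeRing }

  open CommutativeRing ring using (_+_; _*_; -_; 0#; 1#; +-comm; +-assoc; +-identityˡ; +-identityʳ; -‿inverseʳ)
  open import Algebra.Properties.Ring (CommutativeRing.ring ring)
    using (-0#≈0#; -‿involutive; -‿distribˡ-*; -‿distribʳ-*; -‿anti-homo-+)
  open import Algebra.Properties.Semiring.Mult (CommutativeRing.semiring ring)
    using (×-homo-+; ×1-homo-*) renaming (_×_ to _·_)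
  open ≡-Reasoning

  ι : ℤ → A
  ι (ℤ.+ n)    = n · 1#
  ι -[1+ n ]   = - (suc n · 1#)

  private
    signed : Sign → A → A
    signed Sign.+ x = x
    signed Sign.- x = - x

    signed-* : ∀ s t x y → signed (s Sign.* t) (x * y) ≡ signed s x * signed t y
    signed-* Sign.+ Sign.+ x y = refl
    signed-* Sign.+ Sign.- x y = -‿distribʳ-* x y
    signed-* Sign.- Sign.+ x y = -‿distribˡ-* x y
    signed-* Sign.- Sign.- x y = begin
      x * y           ≡⟨ -‿involutive (x * y) ⟨
      - - (x * y)     ≡⟨ cong -_ (-‿distribʳ-* x y) ⟩
      - (x * - y)     ≡⟨ -‿distribˡ-* x (- y) ⟩
      - x * - y       ∎

    ι-◃ : ∀ s n → ι (s ℤ.◃ n) ≡ signed s (n · 1#)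
    ι-◃ Sign.+ zero    = refl
    ι-◃ Sign.- zero    = sym -0#≈0#
    ι-◃ Sign.+ (suc n) = refl
    ι-◃ Sign.- (suc n) = refl

    ι≡signed : ∀ i → ι i ≡ signed (ℤ.sign i) (ℤ.∣ i ∣ · 1#)
    ι≡signed (ℤ.+ n)  = refl
    ι≡signed -[1+ n ] = refl

    1+x-[1+y]≡x-y : ∀ x y → (1# + x) + - (1# + y) ≡ x + - y
    1+x-[1+y]≡x-y x y = begin
      (1# + x) + - (1# + y)       ≡⟨ cong ((1# + x) +_) (-‿anti-homo-+ 1# y) ⟩
      (1# + x) + (- y + - 1#)     ≡⟨ cong (_+ (- y + - 1#)) (+-comm 1# x) ⟩
      (x + 1#) + (- y + - 1#)     ≡⟨ +-assoc x 1# _ ⟩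
      x + (1# + (- y + - 1#))     ≡⟨ cong (x +_) (trans (cong (1# +_) (+-comm (- y) (- 1#))) (sym (+-assoc 1# (- 1#) (- y)))) ⟩
      x + ((1# + - 1#) + - y)     ≡⟨ cong (λ z → x + (z + - y)) (-‿inverseʳ 1#) ⟩
      x + (0# + - y)              ≡⟨ cong (x +_) (+-identityˡ (- y)) ⟩
      x + - y                     ∎

    ι-⊖ : ∀ m n → ι (m ℤ.⊖ n) ≡ m · 1# + - (n · 1#)
    ι-⊖ zero    zero    = sym (trans (+-identityˡ _) -0#≈0#)
    ι-⊖ zero    (suc n) = sym (+-identityˡ _)
    ι-⊖ (suc m) zero    = sym (trans (cong (suc m · 1# +_) -0#≈0#) (+-identityʳ _))
    ι-⊖ (suc m) (suc n) = begin
      ι (suc m ℤ.⊖ suc n)            ≡⟨ cong ι (ℤ.[1+m]⊖[1+n]≡m⊖n m n) ⟩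
      ι (m ℤ.⊖ n)                    ≡⟨ ι-⊖ m n ⟩
      m · 1# + - (n · 1#)            ≡⟨ 1+x-[1+y]≡x-y _ _ ⟨
      suc m · 1# + - (suc n · 1#)    ∎

    ι-+ : ∀ i j → ι (i ℤ.+ j) ≡ ι i + ι j
    ι-+ -[1+ m ] -[1+ n ] = begin
      - (suc (suc (m ℕ.+ n)) · 1#)          ≡⟨ cong (λ k → - (suc k · 1#)) (ℕ.+-suc m n) ⟨
      - ((suc m ℕ.+ suc n) · 1#)            ≡⟨ cong -_ (×-homo-+ 1# (suc m) (suc n)) ⟩
      - (suc m · 1# + suc n · 1#)           ≡⟨ -‿anti-homo-+ _ _ ⟩
      - (suc n · 1#) + - (suc m · 1#)       ≡⟨ +-comm _ _ ⟩
      - (suc m · 1#) + - (suc n · 1#)       ∎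
    ι-+ -[1+ m ] (ℤ.+ n)  = trans (ι-⊖ n (suc m)) (+-comm _ _)
    ι-+ (ℤ.+ m)  -[1+ n ] = ι-⊖ m (suc n)
    ι-+ (ℤ.+ m)  (ℤ.+ n)  = ×-homo-+ 1# m n

    ι-* : ∀ i j → ι (i ℤ.* j) ≡ ι i * ι j
    ι-* i j = begin
      ι (i ℤ.* j)                                  ≡⟨ ι-◃ (ℤ.sign i Sign.* ℤ.sign j) (ℤ.∣ i ∣ ℕ.* ℤ.∣ j ∣) ⟩
      signed (ℤ.sign i Sign.* ℤ.sign j) ((ℤ.∣ i ∣ ℕ.* ℤ.∣ j ∣) · 1#)
        ≡⟨ cong (signed (ℤ.sign i Sign.* ℤ.sign j)) (×1-homo-* ℤ.∣ i ∣ ℤ.∣ j ∣) ⟩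
      signed (ℤ.sign i Sign.* ℤ.sign j) ((ℤ.∣ i ∣ · 1#) * (ℤ.∣ j ∣ · 1#))
        ≡⟨ signed-* (ℤ.sign i) (ℤ.sign j) _ _ ⟩
      signed (ℤ.sign i) (ℤ.∣ i ∣ · 1#) * signed (ℤ.sign j) (ℤ.∣ j ∣ · 1#)
        ≡⟨ cong₂ _*_ (ι≡signed i) (ι≡signed j) ⟨
      ι i * ι j                                    ∎

    ι-‿ : ∀ i → ι (ℤ.- i) ≡ - ι i
    ι-‿ -[1+ n ]    = sym (-‿involutive _)
    ι-‿ (ℤ.+ zero)  = sym -0#≈0#
    ι-‿ (ℤ.+ suc n) = refl

    homomorphism : ℤ.+-*-rawRing ACR.-Raw-AlmostCommutative⟶ ACR.fromCommutativeRing ring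
    homomorphism = record
      { ⟦_⟧ = ι ; +-homo = ι-+ ; *-homo = ι-* ; -‿homo = ι-‿ ; 0-homo = refl ; 1-homo = +-identityʳ 1# }

    ι-≟ : ∀ i j → Maybe (ι i ≡ ι j)
    ι-≟ i j with i ℤ.≟ j
    ... | yes i≡j = just (cong ι i≡j)
    ... | no  _   = nothing

  open Algebra.Solver.Ring ℤ.+-*-rawRing (ACR.fromCommutativeRing ring) homomorphism ι-≟ public

module FiniteFieldProperties {n : ℕ} (F : FiniteField n) where

  open FiniteField F
  open Plane F using (pow)
  open IntegerCoefficientSolver isCommutativeRing
  open CommutativeRing ring
    using (+-comm; +-assoc; +-identityˡ; +-identityʳ; -‿inverseʳ; -‿inverseˡ; *-assoc; *-comm; *-identityˡ; *-identityʳ;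
           zeroˡ; zeroʳ; +-commutativeMonoid; *-commutativeMonoid; semiring)
  open import Algebra.Properties.Ring (CommutativeRing.ring ring)
    using (-0#≈0#; -‿involutive; +-identityˡ-unique; x∙y⁻¹≈ε⇒x≈y)
  open import Algebra.Properties.Semiring.Exp semiring using (_^_; ^-homo-*; ^-assocʳ)
  open import Algebra.Properties.CommutativeSemiring.Exp (CommutativeRing.commutativeSemiring ring) using (^-distrib-*)
  open import Algebra.Properties.Semiring.Mult semiring using (×1-homo-*; ×-assoc-*) renaming (_×_ to _·_)
  open ≡-Reasoning

  private
    module Binomial = Algebra.Properties.CommutativeSemiring.Binomial (CommutativeRing.commutativeSemiring ring)
    module E = Inverse enumeration

  infix 4 _≟_
  _≟_ : DecidableEquality Carrier
  x ≟ y with E.to x Fin.≟ E.to y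
  ... | yes e = yes (trans (sym (E.strictlyInverseʳ x)) (trans (cong E.from e) (E.strictlyInverseʳ y)))
  ... | no ne = no (ne ∘ cong E.to)

  elements : List Carrier
  elements = map E.from (allFin n)

  ∈-elements : ∀ x → x ∈ elements
  ∈-elements x = subst (_∈ elements) (E.strictlyInverseʳ x) (∈.∈-map⁺ E.from (∈.∈-allFin (E.to x)))

  elements-unique : Unique elements
  elements-unique = Unique.map⁺ (λ {i} {j} e → trans (sym (E.strictlyInverseˡ i)) (trans (cong E.to e) (E.strictlyInverseˡ j)))
                                (Unique.allFin⁺ n)

  length-elements : length elements ≡ n
  length-elements = trans (List.length-map E.from (allFin n)) (List.length-tabulate _)

  1≢0 : ¬ 1# ≡ 0#
  1≢0 = 0≢1 ∘ sym

  -- Junk value: 0# ⁻¹ = 0#.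
  _⁻¹ : Carrier → Carrier
  x ⁻¹ with x ≟ 0#
  ... | yes _   = 0#
  ... | no  x≢0 = proj₁ (inverse x x≢0)

  *-inverseʳ : ∀ {x} → ¬ x ≡ 0# → x * x ⁻¹ ≡ 1#
  *-inverseʳ {x} x≢0 with x ≟ 0#
  ... | yes x≡0 = ⊥-elim (x≢0 x≡0)
  ... | no  x≢0 = proj₂ (inverse x x≢0)

  *-inverseˡ : ∀ {x} → ¬ x ≡ 0# → x ⁻¹ * x ≡ 1#
  *-inverseˡ x≢0 = trans (*-comm _ _) (*-inverseʳ x≢0)

  *-cancelˡ-≡ : ∀ {x} y z → ¬ x ≡ 0# → x * y ≡ x * z → y ≡ z
  *-cancelˡ-≡ {x} y z x≢0 xy≡xz = begin
    y               ≡⟨ *-identityˡ y ⟨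
    1# * y          ≡⟨ cong (_* y) (*-inverseˡ x≢0) ⟨
    (x ⁻¹ * x) * y  ≡⟨ *-assoc _ _ _ ⟩
    x ⁻¹ * (x * y)  ≡⟨ cong (x ⁻¹ *_) xy≡xz ⟩
    x ⁻¹ * (x * z)  ≡⟨ *-assoc _ _ _ ⟨
    (x ⁻¹ * x) * z  ≡⟨ cong (_* z) (*-inverseˡ x≢0) ⟩
    1# * z          ≡⟨ *-identityˡ z ⟩
    z               ∎

  x*y≡0⇒x≡0∨y≡0 : ∀ x y → x * y ≡ 0# → x ≡ 0# ⊎ y ≡ 0#
  x*y≡0⇒x≡0∨y≡0 x y xy≡0 with x ≟ 0#
  ... | yes x≡0 = inj₁ x≡0
  ... | no  x≢0 = inj₂ (*-cancelˡ-≡ y 0# x≢0 (trans xy≡0 (sym (zeroʳ x))))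

  *-≢0 : ∀ {x y} → ¬ x ≡ 0# → ¬ y ≡ 0# → ¬ x * y ≡ 0#
  *-≢0 {x} {y} x≢0 y≢0 xy≡0 with x*y≡0⇒x≡0∨y≡0 x y xy≡0
  ... | inj₁ x≡0 = x≢0 x≡0
  ... | inj₂ y≡0 = y≢0 y≡0

  ⁻¹-≢0 : ∀ {x} → ¬ x ≡ 0# → ¬ x ⁻¹ ≡ 0#
  ⁻¹-≢0 {x} x≢0 x⁻¹≡0 = 1≢0 (trans (sym (*-inverseʳ x≢0)) (trans (cong (x *_) x⁻¹≡0) (zeroʳ x)))

  -‿≢0 : ∀ {x} → ¬ x ≡ 0# → ¬ - x ≡ 0#
  -‿≢0 {x} x≢0 -x≡0 = x≢0 (trans (sym (-‿involutive x)) (trans (cong -_ -x≡0) -0#≈0#))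

  pow≡^ : ∀ x k → pow x k ≡ x ^ k
  pow≡^ x zero    = refl
  pow≡^ x (suc k) = cong (x *_) (pow≡^ x k)

  pow-homo-* : ∀ x a b → pow x (a ℕ.+ b) ≡ pow x a * pow x b
  pow-homo-* x a b = begin
    pow x (a ℕ.+ b)    ≡⟨ pow≡^ x (a ℕ.+ b) ⟩
    x ^ (a ℕ.+ b)      ≡⟨ ^-homo-* x a b ⟩
    x ^ a * x ^ b      ≡⟨ cong₂ _*_ (pow≡^ x a) (pow≡^ x b) ⟨
    pow x a * pow x b  ∎

  pow-assocʳ : ∀ x a b → pow (pow x a) b ≡ pow x (a ℕ.* b)
  pow-assocʳ x a b = begin
    pow (pow x a) b  ≡⟨ pow≡^ (pow x a) b ⟩
    pow x a ^ b      ≡⟨ cong (_^ b) (pow≡^ x a) ⟩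
    (x ^ a) ^ b      ≡⟨ ^-assocʳ x a b ⟩
    x ^ (a ℕ.* b)    ≡⟨ pow≡^ x (a ℕ.* b) ⟨
    pow x (a ℕ.* b)  ∎

  pow-distrib-* : ∀ x y k → pow (x * y) k ≡ pow x k * pow y k
  pow-distrib-* x y k = begin
    pow (x * y) k      ≡⟨ pow≡^ (x * y) k ⟩
    (x * y) ^ k        ≡⟨ ^-distrib-* x y k ⟩
    x ^ k * y ^ k      ≡⟨ cong₂ _*_ (pow≡^ x k) (pow≡^ y k) ⟨
    pow x k * pow y k  ∎

  pow-1# : ∀ k → pow 1# k ≡ 1#
  pow-1# zero    = refl
  pow-1# (suc k) = trans (*-identityˡ _) (pow-1# k)

  pow-≢0 : ∀ {x} k → ¬ x ≡ 0# → ¬ pow x k ≡ 0#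
  pow-≢0 zero    x≢0 = 1≢0
  pow-≢0 (suc k) x≢0 = *-≢0 x≢0 (pow-≢0 k x≢0)

  pow≡0⇒≡0 : ∀ {x} k → pow x k ≡ 0# → x ≡ 0#
  pow≡0⇒≡0 {x} k xᵏ≡0 with x ≟ 0#
  ... | yes x≡0 = x≡0
  ... | no  x≢0 = ⊥-elim (pow-≢0 k x≢0 xᵏ≡0)

  private
    module Product = CommutativeMonoidSum *-commutativeMonoid
    module Sum     = CommutativeMonoidSum +-commutativeMonoid

    induced-permutation : ∀ {k} → Carrier ↔ Fin k → (f g : Carrier → Carrier) →
                          (∀ y → f (g y) ≡ y) → (∀ y → g (f y) ≡ y) → Permutation k k
    induced-permutation E f g f∘g≡id g∘f≡id = permutation (λ i → to (f (from i))) (λ i → to (g (from i)))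
      (λ i → trans (cong (to ∘ f) (strictlyInverseʳ _)) (trans (cong to (f∘g≡id (from i))) (strictlyInverseˡ i)))
      (λ i → trans (cong (to ∘ g) (strictlyInverseʳ _)) (trans (cong to (g∘f≡id (from i))) (strictlyInverseˡ i)))
      where open Inverse E using (to; from; strictlyInverseˡ; strictlyInverseʳ)

    product-≢0 : ∀ {j} (f : Fin j → Carrier) → (∀ i → ¬ f i ≡ 0#) → ¬ Product.sum f ≡ 0#
    product-≢0 {zero}  f _   = 1≢0
    product-≢0 {suc j} f f≢0 = *-≢0 (f≢0 fzero) (product-≢0 (f ∘ fsuc) (f≢0 ∘ fsuc))

    orOne : Carrier → Carrier
    orOne y with y ≟ 0#
    ... | yes _ = 1#
    ... | no  _ = y

    orOne-≢0 : ∀ y → ¬ orOne y ≡ 0#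
    orOne-≢0 y with y ≟ 0#
    ... | yes _   = 1≢0
    ... | no  y≢0 = y≢0

    scaleFactor : Carrier → Carrier → Carrier
    scaleFactor a y with y ≟ 0#
    ... | yes _ = 1#
    ... | no  _ = a

    scaleFactor-0# : ∀ a → scaleFactor a 0# ≡ 1#
    scaleFactor-0# a with 0# ≟ 0#
    ... | yes _   = refl
    ... | no  0≢0 = ⊥-elim (0≢0 refl)

    orOne-* : ∀ {a} → ¬ a ≡ 0# → ∀ y → orOne (a * y) ≡ scaleFactor a y * orOne y
    orOne-* {a} a≢0 y with y ≟ 0# | a * y ≟ 0#
    ... | yes _   | yes _     = sym (*-identityˡ 1#)
    ... | yes y≡0 | no  ay≢0  = ⊥-elim (ay≢0 (trans (cong (a *_) y≡0) (zeroʳ a)))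
    ... | no  y≢0 | yes ay≡0  = ⊥-elim (*-≢0 a≢0 y≢0 ay≡0)
    ... | no  _   | no  _     = refl

  ·-size≡0 : ∀ {k} → Carrier ↔ Fin k → ∀ a → k · a ≡ 0#
  ·-size≡0 {k} E a = +-identityˡ-unique (k · a) S (sym S≡k·a+S)
    where
    open Inverse E using (to; from; strictlyInverseʳ)
    translation : Permutation k k
    translation = induced-permutation E (a +_) (- a +_)
      (λ y → trans (sym (+-assoc _ _ _)) (trans (cong (_+ y) (-‿inverseʳ a)) (+-identityˡ y)))
      (λ y → trans (sym (+-assoc _ _ _)) (trans (cong (_+ y) (-‿inverseˡ a)) (+-identityˡ y)))
    S : Carrier
    S = Sum.sum from
    S≡k·a+S : S ≡ k · a + S
    S≡k·a+S = begin
      S                                       ≡⟨ Sum.sum-permute from translation ⟩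
      Sum.sum (λ i → from (to (a + from i)))  ≡⟨ Sum.sum-cong-≗ (λ i → strictlyInverseʳ (a + from i)) ⟩
      Sum.sum (λ i → a + from i)              ≡⟨ Sum.∑-distrib-+ (λ _ → a) from ⟩
      Sum.sum {k} (λ _ → a) + S               ≡⟨ cong (_+ S) (Sum.sum-replicate k) ⟩
      k · a + S                               ∎

  -- With 0# counted as 1#, the product P of all elements is invariant under y ↦ a * y, which
  -- multiplies it by a^(k-1).
  pow-[size∸1]≡1 : ∀ {k} → Carrier ↔ Fin k → ∀ {a} → ¬ a ≡ 0# → pow a (k ∸ 1) ≡ 1#
  pow-[size∸1]≡1 {zero}  E _ with () ← Inverse.to E 0#
  pow-[size∸1]≡1 {suc m} E {a} a≢0 = sym (*-cancelˡ-≡ 1# (pow a m) P≢0 (trans (*-identityʳ P) (trans P≡aᵐ*P (*-comm _ _))))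
    where
    open Inverse E using (to; from; strictlyInverseˡ; strictlyInverseʳ)
    dilation : Permutation (suc m) (suc m)
    dilation = induced-permutation E (a *_) (a ⁻¹ *_)
      (λ y → trans (sym (*-assoc _ _ _)) (trans (cong (_* y) (*-inverseʳ a≢0)) (*-identityˡ y)))
      (λ y → trans (sym (*-assoc _ _ _)) (trans (cong (_* y) (*-inverseˡ a≢0)) (*-identityˡ y)))
    P : Carrier
    P = Product.sum (λ i → orOne (from i))
    P≢0 : ¬ P ≡ 0#
    P≢0 = product-≢0 _ (λ i → orOne-≢0 (from i))
    scaleFactor-elsewhere : ∀ j → scaleFactor a (from (punchIn (to 0#) j)) ≡ a
    scaleFactor-elsewhere j with from (punchIn (to 0#) j) ≟ 0#
    ... | yes y≡0 = ⊥-elim (Fin.punchInᵢ≢i (to 0#) j (trans (sym (strictlyInverseˡ _)) (cong to y≡0)))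
    ... | no  _   = refl
    ∏scaleFactor≡aᵐ : Product.sum (λ i → scaleFactor a (from i)) ≡ pow a m
    ∏scaleFactor≡aᵐ = begin
      Product.sum (λ i → scaleFactor a (from i))
        ≡⟨ Product.sum-remove {i = to 0#} (λ i → scaleFactor a (from i)) ⟩
      scaleFactor a (from (to 0#)) * Product.sum (λ j → scaleFactor a (from (punchIn (to 0#) j)))
        ≡⟨ cong₂ _*_ (cong (scaleFactor a) (strictlyInverseʳ 0#)) (Product.sum-cong-≗ scaleFactor-elsewhere) ⟩
      scaleFactor a 0# * Product.sum {m} (λ _ → a)
        ≡⟨ cong₂ _*_ (scaleFactor-0# a) (Product.sum-replicate m) ⟩
      1# * a ^ m                      ≡⟨ *-identityˡ _ ⟩
      a ^ m                           ≡⟨ pow≡^ a m ⟨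
      pow a m                         ∎
    P≡aᵐ*P : P ≡ pow a m * P
    P≡aᵐ*P = begin
      P                                                             ≡⟨ Product.sum-permute (λ i → orOne (from i)) dilation ⟩
      Product.sum (λ i → orOne (from (to (a * from i))))            ≡⟨ Product.sum-cong-≗ {suc m} {λ i → orOne (from (to (a * from i)))}
                                                                         (λ i → cong orOne (strictlyInverseʳ _)) ⟩
      Product.sum (λ i → orOne (a * from i))                        ≡⟨ Product.sum-cong-≗ {suc m} {λ i → orOne (a * from i)}
                                                                         (λ i → orOne-* a≢0 (from i)) ⟩
      Product.sum (λ i → scaleFactor a (from i) * orOne (from i))   ≡⟨ Product.∑-distrib-+ (λ i → scaleFactor a (from i)) (λ i → orOne (from i)) ⟩
      Product.sum (λ i → scaleFactor a (from i)) * P                ≡⟨ cong (_* P) ∏scaleFactor≡aᵐ ⟩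
      pow a m * P                                                   ∎

  pow-size≡id : ∀ {k} → Carrier ↔ Fin k → ∀ x → pow x k ≡ x
  pow-size≡id {zero}  E _ with () ← Inverse.to E 0#
  pow-size≡id {suc m} E x with x ≟ 0#
  ... | yes refl = zeroˡ _
  ... | no  x≢0  = trans (cong (x *_) (pow-[size∸1]≡1 E x≢0)) (*-identityʳ x)

  data Monic : ℕ → (Carrier → Carrier) → Set where
    monic-1 : ∀ {f} → (∀ x → f x ≡ 1#) → Monic 0 f
    monic-+ : ∀ {d f} c g → Monic d g → (∀ x → f x ≡ c + x * g x) → Monic (suc d) f

  monic-factor : ∀ {d f} → Monic (suc d) f → ∀ r →
                 Σ (Carrier → Carrier) λ g → Monic d g × (∀ x → f x ≡ f r + (x + - r) * g x)
  monic-factor {zero} {f} (monic-+ c g (monic-1 g≡1) f≡) r = (λ _ → 1#) , monic-1 (λ _ → refl) , λ x → begin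
    f x                            ≡⟨ f≡ x ⟩
    c + x * g x                    ≡⟨ cong (λ z → c + x * z) (g≡1 x) ⟩
    c + x * 1#                     ≡⟨ solve 4 (λ c x r one → c :+ x :* one := (c :+ r :* one) :+ (x :- r) :* one) refl c x r 1# ⟩
    (c + r * 1#) + (x + - r) * 1#  ≡⟨ cong (λ z → (c + r * z) + (x + - r) * 1#) (g≡1 r) ⟨
    (c + r * g r) + (x + - r) * 1# ≡⟨ cong (_+ (x + - r) * 1#) (f≡ r) ⟨
    f r + (x + - r) * 1#           ∎
  monic-factor {suc d} {f} (monic-+ c g g-monic f≡) r with monic-factor g-monic r
  ... | h , h-monic , g≡ = (λ x → g r + x * h x) , monic-+ (g r) h h-monic (λ _ → refl) , λ x → begin
    f x                                           ≡⟨ f≡ x ⟩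
    c + x * g x                                   ≡⟨ cong (λ z → c + x * z) (g≡ x) ⟩
    c + x * (g r + (x + - r) * h x)               ≡⟨ solve 5 (λ c x r gr hx → c :+ x :* (gr :+ (x :- r) :* hx)
                                                       := (c :+ r :* gr) :+ (x :- r) :* (gr :+ x :* hx)) refl c x r (g r) (h x) ⟩
    (c + r * g r) + (x + - r) * (g r + x * h x)   ≡⟨ cong (_+ (x + - r) * (g r + x * h x)) (f≡ r) ⟨
    f r + (x + - r) * (g r + x * h x)             ∎

  length-roots≤degree : ∀ {d f} → Monic d f → ∀ rs → Unique rs → All (λ r → f r ≡ 0#) rs → length rs ≤ d
  length-roots≤degree _             []       _            _             = z≤n
  length-roots≤degree (monic-1 f≡1) (r ∷ _)  _            (fr≡0 ∷ _)     = ⊥-elim (1≢0 (trans (sym (f≡1 r)) fr≡0))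
  length-roots≤degree {suc d} {f} f-monic (r ∷ rs) (r∉rs ∷ rs!) (fr≡0 ∷ frs≡0) with monic-factor f-monic r
  ... | g , g-monic , f≡ = s≤s (length-roots≤degree g-monic rs rs! (roots-of-quotient rs r∉rs frs≡0))
    where
    roots-of-quotient : ∀ ss → All (λ s → ¬ r ≡ s) ss → All (λ s → f s ≡ 0#) ss → All (λ s → g s ≡ 0#) ss
    roots-of-quotient []       _            _             = []
    roots-of-quotient (s ∷ ss) (r≢s ∷ r≢ss) (fs≡0 ∷ fss≡0) = gs≡0 ∷ roots-of-quotient ss r≢ss fss≡0
      where
      [s-r]*gs≡0 : (s + - r) * g s ≡ 0#
      [s-r]*gs≡0 = trans (sym (+-identityˡ _)) (trans (cong (_+ (s + - r) * g s) (sym fr≡0)) (trans (sym (f≡ s)) fs≡0))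
      gs≡0 : g s ≡ 0#
      gs≡0 with x*y≡0⇒x≡0∨y≡0 _ _ [s-r]*gs≡0
      ... | inj₁ s-r≡0 = ⊥-elim (r≢s (sym (x∙y⁻¹≈ε⇒x≈y s r s-r≡0)))
      ... | inj₂ gs≡0  = gs≡0

  monic-pow : ∀ k → Monic k (λ x → pow x k)
  monic-pow zero    = monic-1 (λ _ → refl)
  monic-pow (suc k) = monic-+ 0# (λ x → pow x k) (monic-pow k) (λ _ → sym (+-identityˡ _))

  monic-+-const : ∀ {d f} → Monic (suc d) f → ∀ a → Monic (suc d) (λ x → f x + a)
  monic-+-const (monic-+ c g g-monic f≡) a = monic-+ (c + a) g g-monic (λ x → trans (cong (_+ a) (f≡ x))
    (solve 4 (λ c a x gx → (c :+ x :* gx) :+ a := (c :+ a) :+ x :* gx) refl c a x (g x)))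

  monic-+-linear : ∀ {d f} → Monic (suc (suc d)) f → ∀ b → Monic (suc (suc d)) (λ x → f x + b * x)
  monic-+-linear (monic-+ c g g-monic f≡) b = monic-+ c (λ x → g x + b) (monic-+-const g-monic b) (λ x → trans (cong (_+ b * x) (f≡ x))
    (solve 4 (λ c b x gx → (c :+ x :* gx) :+ b :* x := c :+ x :* (gx :+ b)) refl c b x (g x)))

  ∣⇒·1#≡0 : ∀ {p m} → p · 1# ≡ 0# → p ∣ m → m · 1# ≡ 0#
  ∣⇒·1#≡0 {p} p·1≡0 (divides c refl) = begin
    (c ℕ.* p) · 1#        ≡⟨ ×1-homo-* c p ⟩
    (c · 1#) * (p · 1#)   ≡⟨ cong ((c · 1#) *_) p·1≡0 ⟩
    (c · 1#) * 0#         ≡⟨ zeroʳ _ ⟩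
    0#                    ∎

  private
    binomialTerm-inner≡0 : ∀ {m} → Prime (suc (suc m)) → suc (suc m) · 1# ≡ 0# → ∀ x y (i : Fin (suc m)) →
                           Binomial.binomialTerm x y (suc (suc m)) (fsuc (Fin.inject₁ i)) ≡ 0#
    binomialTerm-inner≡0 {m} p-prime p·1≡0 x y i = begin
      (p C k) · t          ≡⟨ cong ((p C k) ·_) (*-identityˡ t) ⟨
      (p C k) · (1# * t)   ≡⟨ ×-assoc-* (p C k) 1# t ⟨
      ((p C k) · 1#) * t   ≡⟨ cong (_* t) (∣⇒·1#≡0 p·1≡0 (prime∣pCk p-prime (s≤s z≤n) k<p)) ⟩
      0# * t               ≡⟨ zeroˡ t ⟩
      0#                   ∎
      where
      p k : ℕ
      p = suc (suc m)
      k = suc (Fin.toℕ (Fin.inject₁ i))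
      t : Carrier
      t = x ^ k * y ^ (p ∸ k)
      k<p : k < p
      k<p = s≤s (subst (ℕ._< suc m) (sym (Fin.toℕ-inject₁ i)) (Fin.toℕ<n i))

  freshmans-dream : ∀ {p} → Prime p → p · 1# ≡ 0# → ∀ x y → pow (x + y) p ≡ pow x p + pow y p
  freshmans-dream {zero}        p-prime = ⊥-elim (¬prime[0] p-prime)
  freshmans-dream {suc zero}    p-prime = ⊥-elim (¬prime[1] p-prime)
  freshmans-dream {suc (suc m)} p-prime p·1≡0 x y = begin
    pow (x + y) p                                                  ≡⟨ pow≡^ (x + y) p ⟩
    (x + y) ^ p                                                    ≡⟨ Binomial.theorem p x y ⟩
    term fzero + Sum.sum (λ i → term (fsuc i))                     ≡⟨ cong (term fzero +_) (Sum.sum-init-last (λ i → term (fsuc i))) ⟩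
    term fzero + (Sum.sum (λ i → term (fsuc (Fin.inject₁ i))) + term last)
      ≡⟨ cong (λ z → term fzero + (z + term last)) inner≡0 ⟩
    term fzero + (0# + term last)                                  ≡⟨ cong₂ (λ a b → a + (0# + b)) term-first term-last ⟩
    pow y p + (0# + pow x p)                                       ≡⟨ cong (pow y p +_) (+-identityˡ _) ⟩
    pow y p + pow x p                                              ≡⟨ +-comm _ _ ⟩
    pow x p + pow y p                                              ∎
    where
    p : ℕ
    p = suc (suc m)
    term : Fin (suc p) → Carrier
    term = Binomial.binomialTerm x y p
    last : Fin (suc p)
    last = fsuc (Fin.fromℕ (suc m))
    term-first : term fzero ≡ pow y p
    term-first = trans (+-identityʳ _) (trans (*-identityˡ _) (sym (pow≡^ y p)))
    term-last : term last ≡ pow x p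
    term-last = begin
      term last                              ≡⟨ cong (λ k → (p C k) · (x ^ k * y ^ (p ∸ k))) (cong suc (Fin.toℕ-fromℕ (suc m))) ⟩
      (p C p) · (x ^ p * y ^ (p ∸ p))        ≡⟨ cong₂ (λ c k → c · (x ^ p * y ^ k)) (nCn≡1 p) (ℕ.n∸n≡0 p) ⟩
      1 · (x ^ p * 1#)                       ≡⟨ +-identityʳ _ ⟩
      x ^ p * 1#                             ≡⟨ *-identityʳ _ ⟩
      x ^ p                                  ≡⟨ pow≡^ x p ⟨
      pow x p                                ∎
    inner≡0 : Sum.sum (λ i → term (fsuc (Fin.inject₁ i))) ≡ 0#
    inner≡0 = trans (Sum.sum-cong-≗ (binomialTerm-inner≡0 p-prime p·1≡0 x y)) (Sum.sum-replicate-zero (suc m))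

module SquareOrderField (q : ℕ) (q-primePower : IsPrimePower q) (F : FiniteField (q ℕ.* q)) where

  open FiniteField F
  open Plane F using (pow)
  open FiniteFieldProperties F
  open IntegerCoefficientSolver isCommutativeRing
  open CommutativeRing ring using (+-comm; +-identityˡ; +-identityʳ; -‿inverseʳ; *-identityˡ; *-identityʳ; semiring)
  open import Algebra.Properties.Ring (CommutativeRing.ring ring) using (-‿distribˡ-*; x+x≈x⇒x≈0; +-inverseʳ-unique)
  open import Algebra.Properties.Semiring.Mult semiring using (×1-homo-*) renaming (_×_ to _·_)
  open Fibres {A = Carrier} _≟_
  open ≡-Reasoning

  q≡2+ : ∃ λ m → q ≡ suc (suc m)
  q≡2+ = at-least-two q enumeration
    where
    at-least-two : ∀ k → Carrier ↔ Fin (k ℕ.* k) → ∃ λ m → k ≡ suc (suc m)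
    at-least-two zero          E with () ← Inverse.to E 0#
    at-least-two (suc zero)    E = ⊥-elim (0≢1 (trans (sym (strictlyInverseʳ 0#)) (trans (cong from (fin1 (to 0#) (to 1#))) (strictlyInverseʳ 1#))))
      where
      open Inverse E using (to; from; strictlyInverseʳ)
      fin1 : (i j : Fin 1) → i ≡ j
      fin1 Fin.zero Fin.zero = refl
    at-least-two (suc (suc m)) E = m , refl

  private
    p e : ℕ
    p = proj₁ q-primePower
    e = proj₁ (proj₂ q-primePower)
    p-prime : Prime p
    p-prime = proj₁ (proj₂ (proj₂ q-primePower))
    q≡pᵉ : q ≡ p ℕ.^ e
    q≡pᵉ = proj₂ (proj₂ (proj₂ (proj₂ q-primePower)))

  ^·1#≡pow : ∀ a k → (a ℕ.^ k) · 1# ≡ pow (a · 1#) k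
  ^·1#≡pow a zero    = +-identityʳ 1#
  ^·1#≡pow a (suc k) = trans (×1-homo-* a (a ℕ.^ k)) (cong ((a · 1#) *_) (^·1#≡pow a k))

  p·1#≡0 : p · 1# ≡ 0#
  p·1#≡0 = pow≡0⇒≡0 (e ℕ.+ e) (begin
    pow (p · 1#) (e ℕ.+ e)                 ≡⟨ pow-homo-* (p · 1#) e e ⟩
    pow (p · 1#) e * pow (p · 1#) e        ≡⟨ cong₂ _*_ (^·1#≡pow p e) (^·1#≡pow p e) ⟨
    (p ℕ.^ e) · 1# * (p ℕ.^ e) · 1#        ≡⟨ ×1-homo-* (p ℕ.^ e) (p ℕ.^ e) ⟨
    (p ℕ.^ e ℕ.* p ℕ.^ e) · 1#             ≡⟨ cong (λ k → (k ℕ.* k) · 1#) q≡pᵉ ⟨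
    (q ℕ.* q) · 1#                         ≡⟨ ·-size≡0 enumeration 1# ⟩
    0#                                     ∎)

  pow-p^k-homo-+ : ∀ k x y → pow (x + y) (p ℕ.^ k) ≡ pow x (p ℕ.^ k) + pow y (p ℕ.^ k)
  pow-p^k-homo-+ zero    x y = trans (*-identityʳ _) (sym (cong₂ _+_ (*-identityʳ x) (*-identityʳ y)))
  pow-p^k-homo-+ (suc k) x y = begin
    pow (x + y) (p ℕ.* p ℕ.^ k)                          ≡⟨ pow-assocʳ (x + y) p (p ℕ.^ k) ⟨
    pow (pow (x + y) p) (p ℕ.^ k)                        ≡⟨ cong (λ z → pow z (p ℕ.^ k)) (freshmans-dream p-prime p·1#≡0 x y) ⟩
    pow (pow x p + pow y p) (p ℕ.^ k)                    ≡⟨ pow-p^k-homo-+ k (pow x p) (pow y p) ⟩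
    pow (pow x p) (p ℕ.^ k) + pow (pow y p) (p ℕ.^ k)    ≡⟨ cong₂ _+_ (pow-assocʳ x p (p ℕ.^ k)) (pow-assocʳ y p (p ℕ.^ k)) ⟩
    pow x (p ℕ.* p ℕ.^ k) + pow y (p ℕ.* p ℕ.^ k)        ∎

  φ : Carrier → Carrier
  φ x = pow x q

  φ-homo-+ : ∀ x y → φ (x + y) ≡ φ x + φ y
  φ-homo-+ x y = subst (λ k → pow (x + y) k ≡ pow x k + pow y k) (sym q≡pᵉ) (pow-p^k-homo-+ e x y)

  φ-homo-* : ∀ x y → φ (x * y) ≡ φ x * φ y
  φ-homo-* x y = pow-distrib-* x y q

  φ-involutive : ∀ x → φ (φ x) ≡ x
  φ-involutive x = trans (pow-assocʳ x q q) (pow-size≡id enumeration x)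

  φ-injective : ∀ {x y} → φ x ≡ φ y → x ≡ y
  φ-injective {x} {y} φx≡φy = trans (sym (φ-involutive x)) (trans (cong φ φx≡φy) (φ-involutive y))

  φ-0# : φ 0# ≡ 0#
  φ-0# = x+x≈x⇒x≈0 (φ 0#) (trans (sym (φ-homo-+ 0# 0#)) (cong φ (+-identityˡ 0#)))

  φ-1# : φ 1# ≡ 1#
  φ-1# = pow-1# q

  φ-homo-‿ : ∀ x → φ (- x) ≡ - φ x
  φ-homo-‿ x = +-inverseʳ-unique (φ x) (φ (- x)) (trans (sym (φ-homo-+ x (- x))) (trans (cong φ (-‿inverseʳ x)) φ-0#))

  φ≡0⇒≡0 : ∀ {x} → φ x ≡ 0# → x ≡ 0#
  φ≡0⇒≡0 φx≡0 = φ-injective (trans φx≡0 (sym φ-0#))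

  trace : Carrier → Carrier
  trace x = φ x + x

  φ-trace : ∀ x → φ (trace x) ≡ trace x
  φ-trace x = trans (φ-homo-+ (φ x) x) (trans (cong (_+ φ x) (φ-involutive x)) (+-comm x (φ x)))

  monic-x^q+bx+c : ∀ b c → Monic q (λ x → (pow x q + b * x) + c)
  monic-x^q+bx+c b c = subst (λ k → Monic k (λ x → (pow x k + b * x) + c)) (sym (proj₂ q≡2+))
    (monic-+-const (monic-+-linear (monic-pow (suc (suc (proj₁ q≡2+)))) b) c)

  fixedField : List Carrier
  fixedField = filter (λ d → φ d ≟ d) elements

  length-fixedField≤q : length fixedField ≤ q
  length-fixedField≤q = length-roots≤degree (monic-x^q+bx+c (- 1#) 0#) fixedField (Unique.filter⁺ (λ d → φ d ≟ d) elements-unique)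
    (All.map root (All.all-filter (λ d → φ d ≟ d) elements))
    where
    root : ∀ {x} → φ x ≡ x → (pow x q + (- 1#) * x) + 0# ≡ 0#
    root {x} φx≡x = trans (+-identityʳ _) (trans (cong₂ _+_ φx≡x (trans (sym (-‿distribˡ-* 1# x)) (cong -_ (*-identityˡ x)))) (-‿inverseʳ x))

  length-fibre-trace≤q : ∀ d → length (fibre trace d elements) ≤ q
  length-fibre-trace≤q d = length-roots≤degree (monic-x^q+bx+c 1# (- d)) _ (Unique.filter⁺ (λ x → trace x ≟ d) elements-unique)
    (All.map root (All.all-filter (λ x → trace x ≟ d) elements))
    where
    root : ∀ {x} → trace x ≡ d → (pow x q + 1# * x) + - d ≡ 0#
    root {x} trace≡d = trans (cong (λ z → (φ x + z) + - d) (*-identityˡ x)) (trans (cong (_+ - d) trace≡d) (-‿inverseʳ d))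

  sum-length-fibre-trace : sum (map (λ d → length (fibre trace d elements)) fixedField) ≡ q ℕ.* q
  sum-length-fibre-trace = trans (sum-length-fibres trace (Unique.filter⁺ (λ d → φ d ≟ d) elements-unique) elements
    (All.tabulate (λ {x} _ → ∈.∈-filter⁺ (λ d → φ d ≟ d) (∈-elements (trace x)) (φ-trace x)))) length-elements

  -- At most q fixed elements, each with at most q preimages, account for all q² elements.
  length-fibre-trace : ∀ d → φ d ≡ d → length (fibre trace d elements) ≡ q
  length-fibre-trace d φd≡d = All.lookup (All.map⁻ all≡q) (∈.∈-filter⁺ (λ d → φ d ≟ d) (∈-elements d) φd≡d)
    where
    lengths : List ℕ
    lengths = map (λ d → length (fibre trace d elements)) fixedField
    length*q≤sum : length lengths ℕ.* q ≤ sum lengths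
    length*q≤sum = ℕ.≤-trans (ℕ.≤-reflexive (cong (ℕ._* q) (List.length-map _ fixedField)))
                     (ℕ.≤-trans (ℕ.*-monoˡ-≤ q length-fixedField≤q) (ℕ.≤-reflexive (sym sum-length-fibre-trace)))
    all≡q : All (_≡ q) lengths
    all≡q = all≤∧sum≥⇒all≡ lengths (All.map⁺ (All.tabulate (λ {d} _ → length-fibre-trace≤q d))) length*q≤sum

module PlaneCoordinates {n : ℕ} (F : FiniteField n) where

  open FiniteField F
  open Plane F using (Triple; NonZero; scale; Proportional)
  open FiniteFieldProperties F
  open IntegerCoefficientSolver isCommutativeRing
  open CommutativeRing ring using (+-identityʳ; *-identityˡ; *-assoc; zeroˡ; zeroʳ)
  open import Algebra.Properties.Ring (CommutativeRing.ring ring) using (-0#≈0#; x∙y⁻¹≈ε⇒x≈y)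

  zero³ : Triple
  zero³ = (0# , 0# , 0#)

  _+³_ : Triple → Triple → Triple
  (a , b , c) +³ (x , y , z) = (a + x , b + y , c + z)

  cross : Triple → Triple → Triple
  cross (a0 , a1 , a2) (b0 , b1 , b2) = (a1 * b2 + - (a2 * b1) , a2 * b0 + - (a0 * b2) , a0 * b1 + - (a1 * b0))

  dot : Triple → Triple → Carrier
  dot (a0 , a1 , a2) (b0 , b1 , b2) = a0 * b0 + a1 * b1 + a2 * b2

  infix 4 _≟³_
  _≟³_ : DecidableEquality Triple
  (a0 , a1 , a2) ≟³ (b0 , b1 , b2) with a0 ≟ b0 | a1 ≟ b1 | a2 ≟ b2
  ... | yes refl | yes refl | yes refl = yes refl
  ... | no a0≢b0 | _        | _        = no (a0≢b0 ∘ cong proj₁)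
  ... | yes _    | no a1≢b1 | _        = no (a1≢b1 ∘ cong (proj₁ ∘ proj₂))
  ... | yes _    | yes _    | no a2≢b2 = no (a2≢b2 ∘ cong (proj₂ ∘ proj₂))

  ≢zero³⇒nonZero : ∀ {a} → ¬ a ≡ zero³ → NonZero a
  ≢zero³⇒nonZero a≢0 (refl , refl , refl) = a≢0 refl

  -- Cyclic rotation of coordinates commutes with cross, scale and _+³_ definitionally; it is used
  -- to reduce every coordinate argument to the case of a nonzero first coordinate.
  rotate : Triple → Triple
  rotate (x , y , z) = (y , z , x)

  rotate-injective : ∀ {a b} → rotate a ≡ rotate b → a ≡ b
  rotate-injective = cong (rotate ∘ rotate)

  dot-rotate : ∀ a b → dot (rotate a) (rotate b) ≡ dot a b
  dot-rotate (a0 , a1 , a2) (b0 , b1 , b2) =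
    solve 6 (λ a0 a1 a2 b0 b1 b2 → a1 :* b1 :+ a2 :* b2 :+ a0 :* b0 := a0 :* b0 :+ a1 :* b1 :+ a2 :* b2) refl a0 a1 a2 b0 b1 b2

  rotate-nonZero : ∀ {a} → NonZero a → NonZero (rotate a)
  rotate-nonZero a≢0 (a1≡0 , a2≡0 , a0≡0) = a≢0 (a0≡0 , a1≡0 , a2≡0)

  by-rotation : (P : Triple → Set) → (∀ a → P (rotate a) → P a) →
                (∀ a0 a1 a2 → ¬ a0 ≡ 0# → P (a0 , a1 , a2)) → ∀ a → NonZero a → P a
  by-rotation P from-rotated first (a0 , a1 , a2) a≢0 with a0 ≟ 0# | a1 ≟ 0# | a2 ≟ 0#
  ... | no a0≢0 | _       | _       = first _ _ _ a0≢0
  ... | yes _   | no a1≢0 | _       = from-rotated _ (first _ _ _ a1≢0)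
  ... | yes _   | yes _   | no a2≢0 = from-rotated _ (from-rotated _ (first _ _ _ a2≢0))
  ... | yes a0≡0 | yes a1≡0 | yes a2≡0 = ⊥-elim (a≢0 (a0≡0 , a1≡0 , a2≡0))

  private
    x≡y⁻¹*[y*x] : ∀ {y} x → ¬ y ≡ 0# → x ≡ y ⁻¹ * (y * x)
    x≡y⁻¹*[y*x] x y≢0 = trans (sym (*-identityˡ x)) (trans (cong (_* x) (sym (*-inverseˡ y≢0))) (*-assoc _ _ _))

  cross≡0⇒multiple : ∀ a b → NonZero a → cross a b ≡ zero³ → ∃ λ c → b ≡ scale c a
  cross≡0⇒multiple a b a≢0 = by-rotation (λ a → ∀ b → cross a b ≡ zero³ → ∃ λ c → b ≡ scale c a)
    (λ a rotated b eq → let (c , rb≡) = rotated (rotate b) (cong rotate eq) in c , rotate-injective rb≡)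
    first-coordinate a a≢0 b
    where
    first-coordinate : ∀ a0 a1 a2 → ¬ a0 ≡ 0# → ∀ b → cross (a0 , a1 , a2) b ≡ zero³ → ∃ λ c → b ≡ scale c (a0 , a1 , a2)
    first-coordinate a0 a1 a2 a0≢0 (b0 , b1 , b2) eq = c , cong₂ _,_ b0≡ (cong₂ _,_ b1≡ b2≡)
      where
      c : Carrier
      c = b0 * a0 ⁻¹
      a2b0≡a0b2 : a2 * b0 ≡ a0 * b2
      a2b0≡a0b2 = x∙y⁻¹≈ε⇒x≈y _ _ (cong (proj₁ ∘ proj₂) eq)
      a0b1≡a1b0 : a0 * b1 ≡ a1 * b0
      a0b1≡a1b0 = x∙y⁻¹≈ε⇒x≈y _ _ (cong (proj₂ ∘ proj₂) eq)
      rearrange : ∀ a → a0 ⁻¹ * (a * b0) ≡ c * a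
      rearrange a = solve 3 (λ i a b0 → i :* (a :* b0) := (b0 :* i) :* a) refl (a0 ⁻¹) a b0
      b0≡ : b0 ≡ c * a0
      b0≡ = trans (x≡y⁻¹*[y*x] b0 a0≢0) (rearrange a0)
      b1≡ : b1 ≡ c * a1
      b1≡ = trans (x≡y⁻¹*[y*x] b1 a0≢0) (trans (cong (a0 ⁻¹ *_) a0b1≡a1b0) (rearrange a1))
      b2≡ : b2 ≡ c * a2
      b2≡ = trans (x≡y⁻¹*[y*x] b2 a0≢0) (trans (cong (a0 ⁻¹ *_) (sym a2b0≡a0b2)) (rearrange a2))

  cross≡0⇒proportional : ∀ a b → NonZero a → NonZero b → cross a b ≡ zero³ → Proportional b a
  cross≡0⇒proportional a b a≢0 b≢0 eq with cross≡0⇒multiple a b a≢0 eq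
  ... | c , refl = c , c≢0 , refl
    where
    c≢0 : ¬ c ≡ 0#
    c≢0 refl = b≢0 (zeroˡ _ , zeroˡ _ , zeroˡ _)

  cross-scale-scale≡0 : ∀ a b P → cross (scale a P) (scale b P) ≡ zero³
  cross-scale-scale≡0 a b (p0 , p1 , p2) = cong₂ _,_ (vanishes p1 p2) (cong₂ _,_ (vanishes p2 p0) (vanishes p0 p1))
    where
    vanishes : ∀ x y → (a * x) * (b * y) + - ((a * y) * (b * x)) ≡ 0#
    vanishes = solve 4 (λ a b x y → (a :* x) :* (b :* y) :- (a :* y) :* (b :* x) := con 0ℤ) refl a b

  proportional⇒cross≡0 : ∀ a b → Proportional a b → cross a b ≡ zero³
  proportional⇒cross≡0 _ b (c , _ , refl) = subst (λ b′ → cross (scale c b) b′ ≡ zero³) (scale-1# b) (cross-scale-scale≡0 c 1# b)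
    where
    scale-1# : ∀ b → scale 1# b ≡ b
    scale-1# (b0 , b1 , b2) = cong₂ _,_ (*-identityˡ b0) (cong₂ _,_ (*-identityˡ b1) (*-identityˡ b2))

  cross≡0-sym : ∀ a b → cross a b ≡ zero³ → cross b a ≡ zero³
  cross≡0-sym (a0 , a1 , a2) (b0 , b1 , b2) eq =
    cong₂ _,_ (flip (cong proj₁ eq)) (cong₂ _,_ (flip (cong (proj₁ ∘ proj₂) eq)) (flip (cong (proj₂ ∘ proj₂) eq)))
    where
    flip : ∀ {x y z w} → x * y + - (z * w) ≡ 0# → w * z + - (y * x) ≡ 0#
    flip {x} {y} {z} {w} e = trans (solve 4 (λ x y z w → w :* z :- y :* x := :- (x :* y :- z :* w)) refl x y z w) (trans (cong -_ e) -0#≈0#)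

  dot-scale : ∀ c a x → dot (scale c a) x ≡ c * dot a x
  dot-scale c (a0 , a1 , a2) (x0 , x1 , x2) = solve 7 (λ c a0 a1 a2 x0 x1 x2 →
    (c :* a0) :* x0 :+ (c :* a1) :* x1 :+ (c :* a2) :* x2 := c :* (a0 :* x0 :+ a1 :* x1 :+ a2 :* x2)) refl c a0 a1 a2 x0 x1 x2

  -- From L × (A × B) = (L·B) A - (L·A) B.
  cross-cross≡0 : ∀ L A B → dot L A ≡ 0# → dot L B ≡ 0# → cross L (cross A B) ≡ zero³
  cross-cross≡0 (l0 , l1 , l2) (a0 , a1 , a2) (b0 , b1 , b2) LA≡0 LB≡0 = cong₂ _,_ e0 (cong₂ _,_ e1 e2)
    where
    LA LB : Carrier
    LA = l0 * a0 + l1 * a1 + l2 * a2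
    LB = l0 * b0 + l1 * b1 + l2 * b2
    vanishes : ∀ x y → x * LB + - (y * LA) ≡ 0#
    vanishes x y = trans (cong₂ (λ u v → x * u + - (y * v)) LB≡0 LA≡0)
      (solve 2 (λ x y → x :* con 0ℤ :- y :* con 0ℤ := con 0ℤ) refl x y)
    e0 : l1 * (a0 * b1 + - (a1 * b0)) + - (l2 * (a2 * b0 + - (a0 * b2))) ≡ 0#
    e0 = trans (solve 9 (λ l0 l1 l2 a0 a1 a2 b0 b1 b2 →
      l1 :* (a0 :* b1 :- a1 :* b0) :- l2 :* (a2 :* b0 :- a0 :* b2)
        := a0 :* (l0 :* b0 :+ l1 :* b1 :+ l2 :* b2) :- b0 :* (l0 :* a0 :+ l1 :* a1 :+ l2 :* a2)) refl l0 l1 l2 a0 a1 a2 b0 b1 b2) (vanishes a0 b0)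
    e1 : l2 * (a1 * b2 + - (a2 * b1)) + - (l0 * (a0 * b1 + - (a1 * b0))) ≡ 0#
    e1 = trans (solve 9 (λ l0 l1 l2 a0 a1 a2 b0 b1 b2 →
      l2 :* (a1 :* b2 :- a2 :* b1) :- l0 :* (a0 :* b1 :- a1 :* b0)
        := a1 :* (l0 :* b0 :+ l1 :* b1 :+ l2 :* b2) :- b1 :* (l0 :* a0 :+ l1 :* a1 :+ l2 :* a2)) refl l0 l1 l2 a0 a1 a2 b0 b1 b2) (vanishes a1 b1)
    e2 : l0 * (a2 * b0 + - (a0 * b2)) + - (l1 * (a1 * b2 + - (a2 * b1))) ≡ 0#
    e2 = trans (solve 9 (λ l0 l1 l2 a0 a1 a2 b0 b1 b2 →
      l0 :* (a2 :* b0 :- a0 :* b2) :- l1 :* (a1 :* b2 :- a2 :* b1)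
        := a2 :* (l0 :* b0 :+ l1 :* b1 :+ l2 :* b2) :- b2 :* (l0 :* a0 :+ l1 :* a1 :+ l2 :* a2)) refl l0 l1 l2 a0 a1 a2 b0 b1 b2) (vanishes a2 b2)

  line-through : ∀ L A B → NonZero L → dot L A ≡ 0# → dot L B ≡ 0# → NonZero (cross A B) → Proportional L (cross A B)
  line-through L A B L≢0 LA≡0 LB≡0 A×B≢0 =
    cross≡0⇒proportional (cross A B) L A×B≢0 L≢0 (cross≡0-sym L (cross A B) (cross-cross≡0 L A B LA≡0 LB≡0))

  collinear⇒det≡0 : ∀ L A B X → NonZero L → dot L A ≡ 0# → dot L B ≡ 0# → dot L X ≡ 0# → dot (cross A B) X ≡ 0#
  collinear⇒det≡0 L A B X L≢0 LA≡0 LB≡0 LX≡0 =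
    let c , A×B≡cL = cross≡0⇒multiple L (cross A B) L≢0 (cross-cross≡0 L A B LA≡0 LB≡0)
    in trans (cong (λ w → dot w X) A×B≡cL) (trans (dot-scale c L X) (trans (cong (c *_) LX≡0) (zeroʳ c)))

  det≡0⇒combination : ∀ P v X → NonZero (cross P v) → dot (cross P v) X ≡ 0# →
                      ∃ λ α → ∃ λ β → X ≡ scale α P +³ scale β v
  det≡0⇒combination P v X P×v≢0 = by-rotation Combination from-rotated cramer (cross P v) P×v≢0 P v X refl
    where
    Combination : Triple → Set
    Combination w = ∀ P v X → cross P v ≡ w → dot w X ≡ 0# → ∃ λ α → ∃ λ β → X ≡ scale α P +³ scale β v
    from-rotated : ∀ w → Combination (rotate w) → Combination w
    from-rotated w combination P v X refl wX≡0
      with combination (rotate P) (rotate v) (rotate X) refl (trans (dot-rotate _ _) wX≡0)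
    ... | α , β , rX≡ = α , β , rotate-injective rX≡
    cramer : ∀ w0 w1 w2 → ¬ w0 ≡ 0# → Combination (w0 , w1 , w2)
    cramer _ _ _ w0≢0 (p0 , p1 , p2) (v0 , v1 , v2) (x0 , x1 , x2) refl det≡0 =
      a * w⁻¹ , b * w⁻¹ , cong₂ _,_ x0≡ (cong₂ _,_ x1≡ x2≡)
      where
      w w⁻¹ a b : Carrier
      w = p1 * v2 + - (p2 * v1)
      w⁻¹ = w ⁻¹
      a = v2 * x1 + - (v1 * x2)
      b = p1 * x2 + - (p2 * x1)
      divide : ∀ pj vj → w⁻¹ * (a * pj + b * vj) ≡ (a * w⁻¹) * pj + (b * w⁻¹) * vj
      divide pj vj = solve 5 (λ i a b pj vj → i :* (a :* pj :+ b :* vj) := (a :* i) :* pj :+ (b :* i) :* vj) refl w⁻¹ a b pj vj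
      wx0≡ : w * x0 ≡ (a * p0 + b * v0) + dot (p1 * v2 + - (p2 * v1) , p2 * v0 + - (p0 * v2) , p0 * v1 + - (p1 * v0)) (x0 , x1 , x2)
      wx0≡ = solve 9 (λ p0 p1 p2 v0 v1 v2 x0 x1 x2 → (p1 :* v2 :- p2 :* v1) :* x0 :=
        ((v2 :* x1 :- v1 :* x2) :* p0 :+ (p1 :* x2 :- p2 :* x1) :* v0) :+
        ((p1 :* v2 :- p2 :* v1) :* x0 :+ (p2 :* v0 :- p0 :* v2) :* x1 :+ (p0 :* v1 :- p1 :* v0) :* x2)) refl p0 p1 p2 v0 v1 v2 x0 x1 x2
      wx1≡ : w * x1 ≡ a * p1 + b * v1
      wx1≡ = solve 9 (λ p0 p1 p2 v0 v1 v2 x0 x1 x2 → (p1 :* v2 :- p2 :* v1) :* x1 :=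
        (v2 :* x1 :- v1 :* x2) :* p1 :+ (p1 :* x2 :- p2 :* x1) :* v1) refl p0 p1 p2 v0 v1 v2 x0 x1 x2
      wx2≡ : w * x2 ≡ a * p2 + b * v2
      wx2≡ = solve 9 (λ p0 p1 p2 v0 v1 v2 x0 x1 x2 → (p1 :* v2 :- p2 :* v1) :* x2 :=
        (v2 :* x1 :- v1 :* x2) :* p2 :+ (p1 :* x2 :- p2 :* x1) :* v2) refl p0 p1 p2 v0 v1 v2 x0 x1 x2
      x0≡ : x0 ≡ (a * w⁻¹) * p0 + (b * w⁻¹) * v0
      x0≡ = trans (x≡y⁻¹*[y*x] x0 w0≢0) (trans (cong (w⁻¹ *_) (trans wx0≡ (trans (cong ((a * p0 + b * v0) +_) det≡0) (+-identityʳ (a * p0 + b * v0))))) (divide p0 v0))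
      x1≡ : x1 ≡ (a * w⁻¹) * p1 + (b * w⁻¹) * v1
      x1≡ = trans (x≡y⁻¹*[y*x] x1 w0≢0) (trans (cong (w⁻¹ *_) wx1≡) (divide p1 v1))
      x2≡ : x2 ≡ (a * w⁻¹) * p2 + (b * w⁻¹) * v2
      x2≡ = trans (x≡y⁻¹*[y*x] x2 w0≢0) (trans (cong (w⁻¹ *_) wx2≡) (divide p2 v2))

  another-point-on-line : ∀ L P → NonZero L → NonZero P → dot L P ≡ 0# →
                          ∃ λ v → NonZero v × dot L v ≡ 0# × ¬ cross v P ≡ zero³
  another-point-on-line L P L≢0 = by-rotation Another from-rotated candidates L L≢0 P
    where
    Another : Triple → Set
    Another L = ∀ P → NonZero P → dot L P ≡ 0# → ∃ λ v → NonZero v × dot L v ≡ 0# × ¬ cross v P ≡ zero³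
    from-rotated : ∀ L → Another (rotate L) → Another L
    from-rotated L another P P≢0 LP≡0 with another (rotate P) (rotate-nonZero P≢0) (trans (dot-rotate L P) LP≡0)
    ... | v , v≢0 , Lv≡0 , v×P≢0 =
      rotate (rotate v) , rotate-nonZero (rotate-nonZero v≢0) , trans (sym (dot-rotate L (rotate (rotate v)))) Lv≡0 , v×P≢0 ∘ cong rotate
    -- (-l2, 0, l0) and (l1, -l0, 0) lie on L and are not proportional, so one of them is not proportional to P.
    candidates : ∀ l0 l1 l2 → ¬ l0 ≡ 0# → Another (l0 , l1 , l2)
    candidates l0 l1 l2 l0≢0 P P≢0 _ with cross (- l2 , 0# , l0) P ≟³ zero³ | cross (l1 , - l0 , 0#) P ≟³ zero³
    ... | no A×P≢0 | _ = (- l2 , 0# , l0) , (λ (_ , _ , l0≡0) → l0≢0 l0≡0) ,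
      solve 3 (λ l0 l1 l2 → l0 :* (:- l2) :+ l1 :* con 0ℤ :+ l2 :* l0 := con 0ℤ) refl l0 l1 l2 , A×P≢0
    ... | yes _ | no B×P≢0 = (l1 , - l0 , 0#) , (λ (_ , -l0≡0 , _) → -‿≢0 l0≢0 -l0≡0) ,
      solve 3 (λ l0 l1 l2 → l0 :* l1 :+ l1 :* (:- l0) :+ l2 :* con 0ℤ := con 0ℤ) refl l0 l1 l2 , B×P≢0
    ... | yes A×P≡0 | yes B×P≡0
      with cross≡0⇒multiple P _ P≢0 (cross≡0-sym _ P A×P≡0) | cross≡0⇒multiple P _ P≢0 (cross≡0-sym _ P B×P≡0)
    ... | a , A≡aP | b , B≡bP = ⊥-elim (l0≢0 (reduce (x*y≡0⇒x≡0∨y≡0 l0 l0 l0*l0≡0)))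
      where
      l0*l0≡0 : l0 * l0 ≡ 0#
      l0*l0≡0 = trans (solve 1 (λ l0 → l0 :* l0 := con 0ℤ :* con 0ℤ :- l0 :* (:- l0)) refl l0)
                      (cong proj₁ (trans (cong₂ cross A≡aP B≡bP) (cross-scale-scale≡0 a b P)))

module PointSetProperties {n : ℕ} (F : FiniteField n) where

  open FiniteField F
  open Plane F
  open FiniteFieldProperties F
  open CommutativeRing (IntegerCoefficientSolver.ring isCommutativeRing) using (*-assoc; *-identityˡ)
  open PlaneCoordinates F using (_≟³_)

  proportional? : ∀ X Y → Dec (Proportional X Y)
  proportional? X Y with Any.any? (λ c → ¬? (c ≟ 0#) ×-dec (X ≟³ scale c Y)) elements
  ... | yes p = yes (Any.satisfied p)
  ... | no ¬p = no (λ (c , c≢0 , X≡) → ¬p (Any.map (λ { refl → c≢0 , X≡ }) (∈-elements c)))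

  Proportional-sym : ∀ {X Y} → Proportional X Y → Proportional Y X
  Proportional-sym {_} {y0 , y1 , y2} (c , c≢0 , refl) = c ⁻¹ , ⁻¹-≢0 c≢0 , cong₂ _,_ (undo y0) (cong₂ _,_ (undo y1) (undo y2))
    where
    undo : ∀ y → y ≡ c ⁻¹ * (c * y)
    undo y = trans (sym (*-identityˡ y)) (trans (cong (_* y) (sym (*-inverseˡ c≢0))) (*-assoc _ _ _))

  Proportional-trans : ∀ {X Y Z} → Proportional X Y → Proportional Y Z → Proportional X Z
  Proportional-trans {_} {_} {z0 , z1 , z2} (c , c≢0 , refl) (d , d≢0 , refl) =
    c * d , *-≢0 c≢0 d≢0 , cong₂ _,_ (sym (*-assoc c d z0)) (cong₂ _,_ (sym (*-assoc c d z1)) (sym (*-assoc c d z2)))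

  intermediate-pointSet : ∀ B C k → size B ≤ k → k ≤ size C →
    ∃ λ D → size D ≡ k × (∀ {X} → X ∈ pts B → X ∈ pts D) × (∀ {P : Triple → Set} → All P (pts B) → All P (pts C) → All P (pts D))
  intermediate-pointSet B C k B≤k k≤C = D , size-D , ∈.∈-++⁺ˡ , λ PB PC → All.++⁺ PB (All.take⁺ m (All.filter⁺ new? PC))
    where
    old? : ∀ X → Dec (X ∈ₚ B)
    old? X = Any.any? (proportional? X) (pts B)
    new? : ∀ X → Dec (¬ X ∈ₚ B)
    new? = ¬? ∘ old?
    new : List Triple
    new = filter new? (pts C)
    m : ℕ
    m = k ∸ size B
    old≤B : length (filter old? (pts C)) ≤ size B
    old≤B = length-≤-of-covered proportional? Proportional-sym Proportional-trans (pts B) _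
              (AllPairs.filter⁺ old? (distinct C)) (All.all-filter old? (pts C))
    m≤new : m ≤ length new
    m≤new = ℕ.m≤n+o⇒m∸n≤o k (size B) (ℕ.≤-trans k≤C (ℕ.≤-trans
              (ℕ.≤-reflexive (sym (length-filter+length-filter-¬ old? (pts C)))) (ℕ.+-monoˡ-≤ (length new) old≤B)))
    B≁new : All (λ b → All (λ e → ¬ Proportional b e) (take m new)) (pts B)
    B≁new = All.tabulate (λ b∈B → All.take⁺ m (All.map (λ e∉B b∼e → e∉B (Any.map (λ { refl → Proportional-sym b∼e }) b∈B))
                                                   (All.all-filter new? (pts C))))
    D : PointSet
    D = mkPointSet (pts B ++ take m new)
          (All.++⁺ (nonzero B) (All.take⁺ m (All.filter⁺ new? (nonzero C))))
          (AllPairs.++⁺ (distinct B) (AllPairs.take⁺ m (AllPairs.filter⁺ new? (distinct C))) B≁new)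
    size-D : size D ≡ k
    size-D = trans (List.length-++ (pts B)) (trans (cong (size B ℕ.+_) (trans (List.length-take m new) (ℕ.m≤n⇒m⊓n≡m m≤new)))
                                                   (ℕ.m+[n∸m]≡n B≤k))

module HermitianCurve (q : ℕ) (q-primePower : IsPrimePower q) (F : FiniteField (q ℕ.* q)) where

  open FiniteField F
  open Hermitian q F
  open FiniteFieldProperties F
  open SquareOrderField q q-primePower F
  open PlaneCoordinates F
  open IntegerCoefficientSolver isCommutativeRing
  open CommutativeRing ring using (+-comm; +-identityˡ; +-identityʳ; -‿inverseʳ; *-comm; *-assoc; *-identityˡ; zeroˡ; zeroʳ)
  open import Algebra.Properties.Ring (CommutativeRing.ring ring) using (x∙y⁻¹≈ε⇒x≈y; +-inverseʳ-unique)
  open Fibres {A = Carrier} _≟_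

  -- OnH P is definitionally form P ≡ 0#.
  form : Triple → Carrier
  form (x0 , x1 , x2) = x2 * φ x0 + φ x2 * x0 + x1 * φ x1

  -- The polar line of P with respect to the Hermitian form; for P on the curve it is the tangent at P.
  polar : Triple → Triple
  polar (a0 , a1 , a2) = (φ a2 , φ a1 , φ a0)

  polar-nonZero : ∀ {P} → NonZero P → NonZero (polar P)
  polar-nonZero P≢0 (φa2≡0 , φa1≡0 , φa0≡0) = P≢0 (φ≡0⇒≡0 φa0≡0 , φ≡0⇒≡0 φa1≡0 , φ≡0⇒≡0 φa2≡0)

  polar≡0⇒≡0 : ∀ {X} → polar X ≡ zero³ → X ≡ zero³
  polar≡0⇒≡0 eq = cong₂ _,_ (φ≡0⇒≡0 (cong (proj₂ ∘ proj₂) eq)) (cong₂ _,_ (φ≡0⇒≡0 (cong (proj₁ ∘ proj₂) eq)) (φ≡0⇒≡0 (cong proj₁ eq)))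

  onH⇒on-polar : ∀ P → OnH P → dot (polar P) P ≡ 0#
  onH⇒on-polar (a0 , a1 , a2) P∈H = trans (solve 6 (λ a0 a1 a2 f0 f1 f2 →
    f2 :* a0 :+ f1 :* a1 :+ f0 :* a2 := a2 :* f0 :+ f2 :* a0 :+ a1 :* f1) refl a0 a1 a2 (φ a0) (φ a1) (φ a2)) P∈H

  φ-dot-polar : ∀ P Q → φ (dot (polar P) Q) ≡ dot (polar Q) P
  φ-dot-polar (p0 , p1 , p2) (q0 , q1 , q2) = begin
    φ (φ p2 * q0 + φ p1 * q1 + φ p0 * q2)
      ≡⟨ trans (φ-homo-+ _ _) (cong₂ _+_ (trans (φ-homo-+ _ _) (cong₂ _+_ (φ-homo-* _ _) (φ-homo-* _ _))) (φ-homo-* _ _)) ⟩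
    φ (φ p2) * φ q0 + φ (φ p1) * φ q1 + φ (φ p0) * φ q2
      ≡⟨ cong₂ _+_ (cong₂ _+_ (cong (_* φ q0) (φ-involutive p2)) (cong (_* φ q1) (φ-involutive p1))) (cong (_* φ q2) (φ-involutive p0)) ⟩
    p2 * φ q0 + p1 * φ q1 + p0 * φ q2
      ≡⟨ solve 6 (λ p0 p1 p2 f0 f1 f2 → p2 :* f0 :+ p1 :* f1 :+ p0 :* f2 := f2 :* p0 :+ f1 :* p1 :+ f0 :* p2) refl p0 p1 p2 (φ q0) (φ q1) (φ q2) ⟩
    φ q2 * p0 + φ q1 * p1 + φ q0 * p2 ∎
    where open ≡-Reasoning

  on-polar-sym : ∀ P Q → dot (polar P) Q ≡ 0# → dot (polar Q) P ≡ 0#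
  on-polar-sym P Q PQ≡0 = trans (sym (φ-dot-polar P Q)) (trans (cong φ PQ≡0) φ-0#)

  cross-polar : ∀ P Q → cross (polar P) (polar Q) ≡ polar (cross Q P)
  cross-polar (p0 , p1 , p2) (q0 , q1 , q2) = cong₂ _,_ (minor q0 p1 q1 p0) (cong₂ _,_ (minor q2 p0 q0 p2) (minor q1 p2 q2 p1))
    where
    minor : ∀ a b c d → φ b * φ a + - (φ d * φ c) ≡ φ (a * b + - (c * d))
    minor a b c d = sym (begin
      φ (a * b + - (c * d))          ≡⟨ φ-homo-+ _ _ ⟩
      φ (a * b) + φ (- (c * d))      ≡⟨ cong₂ _+_ (φ-homo-* a b) (trans (φ-homo-‿ _) (cong -_ (φ-homo-* c d))) ⟩
      φ a * φ b + - (φ c * φ d)      ≡⟨ cong₂ (λ u v → u + - v) (*-comm _ _) (*-comm _ _) ⟩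
      φ b * φ a + - (φ d * φ c)      ∎)
      where open ≡-Reasoning

  -- Both polars would contain the line PQ, forcing polar (Q × P) = 0.
  polar-meets-curve-only-at-pole : ∀ P Q → NonZero P → NonZero Q → OnH P → OnH Q → dot (polar P) Q ≡ 0# → Proportional Q P
  polar-meets-curve-only-at-pole P Q P≢0 Q≢0 P∈H Q∈H Q∈polarP with cross P Q ≟³ zero³
  ... | yes P×Q≡0 = cross≡0⇒proportional P Q P≢0 Q≢0 P×Q≡0
  ... | no  P×Q≢0 = ⊥-elim (P×Q≢0 (cross≡0-sym Q P (polar≡0⇒≡0 polar[Q×P]≡0)))
    where
    P×Q-nonZero : NonZero (cross P Q)
    P×Q-nonZero = ≢zero³⇒nonZero P×Q≢0
    polar[Q×P]≡0 : polar (cross Q P) ≡ zero³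
    polar[Q×P]≡0 =
      let a , _ , polarP≡ = line-through (polar P) P Q (polar-nonZero P≢0) (onH⇒on-polar P P∈H) Q∈polarP P×Q-nonZero
          b , _ , polarQ≡ = line-through (polar Q) P Q (polar-nonZero Q≢0) (on-polar-sym P Q Q∈polarP) (onH⇒on-polar Q Q∈H) P×Q-nonZero
      in trans (sym (cross-polar P Q)) (trans (cong₂ cross polarP≡ polarQ≡) (cross-scale-scale≡0 a b (cross P Q)))

  form-self-conjugate : ∀ v → φ (form v) ≡ form v
  form-self-conjugate (v0 , v1 , v2) = begin
    φ (v2 * φ v0 + φ v2 * v0 + v1 * φ v1)
      ≡⟨ trans (φ-homo-+ _ _) (cong₂ _+_ (trans (φ-homo-+ _ _) (cong₂ _+_ (φ-homo-* _ _) (φ-homo-* _ _))) (φ-homo-* _ _)) ⟩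
    φ v2 * φ (φ v0) + φ (φ v2) * φ v0 + φ v1 * φ (φ v1)
      ≡⟨ cong₂ _+_ (cong₂ _+_ (cong (φ v2 *_) (φ-involutive v0)) (cong (_* φ v0) (φ-involutive v2))) (cong (φ v1 *_) (φ-involutive v1)) ⟩
    φ v2 * v0 + v2 * φ v0 + φ v1 * v1
      ≡⟨ solve 6 (λ v0 v1 v2 f0 f1 f2 → f2 :* v0 :+ v2 :* f0 :+ f1 :* v1 := v2 :* f0 :+ f2 :* v0 :+ v1 :* f1) refl v0 v1 v2 (φ v0) (φ v1) (φ v2) ⟩
    v2 * φ v0 + φ v2 * v0 + v1 * φ v1 ∎
    where open ≡-Reasoning

  form-scale : ∀ b Y → form (scale b Y) ≡ (b * φ b) * form Y
  form-scale b (y0 , y1 , y2) = begin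
    (b * y2) * φ (b * y0) + φ (b * y2) * (b * y0) + (b * y1) * φ (b * y1)
      ≡⟨ cong₂ _+_ (cong₂ _+_ (cong ((b * y2) *_) (φ-homo-* b y0)) (cong (_* (b * y0)) (φ-homo-* b y2))) (cong ((b * y1) *_) (φ-homo-* b y1)) ⟩
    (b * y2) * (φ b * φ y0) + (φ b * φ y2) * (b * y0) + (b * y1) * (φ b * φ y1)
      ≡⟨ solve 8 (λ b fb y0 y1 y2 f0 f1 f2 → (b :* y2) :* (fb :* f0) :+ (fb :* f2) :* (b :* y0) :+ (b :* y1) :* (fb :* f1)
           := (b :* fb) :* (y2 :* f0 :+ f2 :* y0 :+ y1 :* f1)) refl b (φ b) y0 y1 y2 (φ y0) (φ y1) (φ y2) ⟩
    (b * φ b) * form (y0 , y1 , y2) ∎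
    where open ≡-Reasoning

  form-line : ∀ v P t → form (v +³ scale t P) ≡ form v + (t * φ t) * form P + trace (t * dot (polar v) P)
  form-line (v0 , v1 , v2) (p0 , p1 , p2) t = begin
    form (v +³ scale t P)
      ≡⟨ cong₂ _+_ (cong₂ _+_ (cong ((v2 + t * p2) *_) (φ-line v0 p0)) (cong (_* (v0 + t * p0)) (φ-line v2 p2))) (cong ((v1 + t * p1) *_) (φ-line v1 p1)) ⟩
    (v2 + t * p2) * (φ v0 + φ t * φ p0) + (φ v2 + φ t * φ p2) * (v0 + t * p0) + (v1 + t * p1) * (φ v1 + φ t * φ p1)
      ≡⟨ solve 14 (λ v0 v1 v2 p0 p1 p2 fv0 fv1 fv2 fp0 fp1 fp2 t ft →
           (v2 :+ t :* p2) :* (fv0 :+ ft :* fp0) :+ (fv2 :+ ft :* fp2) :* (v0 :+ t :* p0) :+ (v1 :+ t :* p1) :* (fv1 :+ ft :* fp1)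
           := (v2 :* fv0 :+ fv2 :* v0 :+ v1 :* fv1) :+ (t :* ft) :* (p2 :* fp0 :+ fp2 :* p0 :+ p1 :* fp1)
              :+ (ft :* (fp2 :* v0 :+ fp1 :* v1 :+ fp0 :* v2) :+ t :* (fv2 :* p0 :+ fv1 :* p1 :+ fv0 :* p2)))
           refl v0 v1 v2 p0 p1 p2 (φ v0) (φ v1) (φ v2) (φ p0) (φ p1) (φ p2) t (φ t) ⟩
    form v + (t * φ t) * form P + (φ t * dot (polar P) v + t * dot (polar v) P)
      ≡⟨ cong (λ z → form v + (t * φ t) * form P + (z + t * dot (polar v) P))
           (sym (trans (φ-homo-* t _) (cong (φ t *_) (φ-dot-polar v P)))) ⟩
    form v + (t * φ t) * form P + trace (t * dot (polar v) P) ∎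
    where
    open ≡-Reasoning
    v P : Triple
    v = (v0 , v1 , v2)
    P = (p0 , p1 , p2)
    φ-line : ∀ a b → φ (a + t * b) ≡ φ a + φ t * φ b
    φ-line a b = trans (φ-homo-+ a (t * b)) (cong (φ a +_) (φ-homo-* t b))

  dot-line : ∀ L v P t → dot L (v +³ scale t P) ≡ dot L v + t * dot L P
  dot-line (l0 , l1 , l2) (v0 , v1 , v2) (p0 , p1 , p2) t = solve 10 (λ l0 l1 l2 v0 v1 v2 p0 p1 p2 t →
    l0 :* (v0 :+ t :* p0) :+ l1 :* (v1 :+ t :* p1) :+ l2 :* (v2 :+ t :* p2)
      := (l0 :* v0 :+ l1 :* v1 :+ l2 :* v2) :+ t :* (l0 :* p0 :+ l1 :* p1 :+ l2 :* p2)) refl l0 l1 l2 v0 v1 v2 p0 p1 p2 t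

  cross-line : ∀ v P t → cross (v +³ scale t P) P ≡ cross v P
  cross-line (v0 , v1 , v2) (p0 , p1 , p2) t = cong₂ _,_ (minor v1 v2 p1 p2) (cong₂ _,_ (minor v2 v0 p2 p0) (minor v0 v1 p0 p1))
    where
    minor : ∀ a b c d → (a + t * c) * d + - ((b + t * d) * c) ≡ a * d + - (b * c)
    minor = solve 5 (λ t a b c d → (a :+ t :* c) :* d :- (b :+ t :* d) :* c := a :* d :- b :* c) refl t

  cross-line-line : ∀ v P t t′ → cross (v +³ scale t P) (v +³ scale t′ P) ≡ scale (t′ + - t) (cross v P)
  cross-line-line (v0 , v1 , v2) (p0 , p1 , p2) t t′ = cong₂ _,_ (minor v1 v2 p1 p2) (cong₂ _,_ (minor v2 v0 p2 p0) (minor v0 v1 p0 p1))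
    where
    minor : ∀ a b c d → (a + t * c) * (b + t′ * d) + - ((b + t * d) * (a + t′ * c)) ≡ (t′ + - t) * (a * d + - (b * c))
    minor = solve 6 (λ t t′ a b c d → (a :+ t :* c) :* (b :+ t′ :* d) :- (b :+ t :* d) :* (a :+ t′ :* c)
                       := (t′ :- t) :* (a :* d :- b :* c)) refl t t′

  scale≡0⇒≡0 : ∀ {k w} → NonZero w → scale k w ≡ zero³ → k ≡ 0#
  scale≡0⇒≡0 {k} {w0 , w1 , w2} w≢0 kw≡0 with k ≟ 0#
  ... | yes k≡0 = k≡0
  ... | no  k≢0 = ⊥-elim (w≢0 (cancel (cong proj₁ kw≡0) , cancel (cong (proj₁ ∘ proj₂) kw≡0) , cancel (cong (proj₂ ∘ proj₂) kw≡0)))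
    where
    cancel : ∀ {x} → k * x ≡ 0# → x ≡ 0#
    cancel {x} kx≡0 = *-cancelˡ-≡ x 0# k≢0 (trans kx≡0 (sym (zeroʳ k)))

  cross-zero³ : ∀ P → cross zero³ P ≡ zero³
  cross-zero³ (p0 , p1 , p2) = cong₂ _,_ (vanishes p1 p2) (cong₂ _,_ (vanishes p2 p0) (vanishes p0 p1))
    where
    vanishes : ∀ a b → 0# * b + - (0# * a) ≡ 0#
    vanishes = solve 2 (λ a b → con 0ℤ :* b :- con 0ℤ :* a := con 0ℤ) refl

  combination-β≡0 : ∀ α P v → scale α P +³ scale 0# v ≡ scale α P
  combination-β≡0 α (p0 , p1 , p2) (v0 , v1 , v2) = cong₂ _,_ (drop p0 v0) (cong₂ _,_ (drop p1 v1) (drop p2 v2))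
    where
    drop : ∀ p v → α * p + 0# * v ≡ α * p
    drop p v = trans (cong (α * p +_) (zeroˡ v)) (+-identityʳ _)

  combination-β≢0 : ∀ α β P v → ¬ β ≡ 0# → scale α P +³ scale β v ≡ scale β (v +³ scale (α * β ⁻¹) P)
  combination-β≢0 α β (p0 , p1 , p2) (v0 , v1 , v2) β≢0 = cong₂ _,_ (factor p0 v0) (cong₂ _,_ (factor p1 v1) (factor p2 v2))
    where
    factor : ∀ x y → α * x + β * y ≡ β * (y + (α * β ⁻¹) * x)
    factor x y = sym (trans (solve 5 (λ b i a x y → b :* (y :+ (a :* i) :* x) := b :* y :+ (b :* i) :* (a :* x)) refl β (β ⁻¹) α x y)
      (trans (cong (λ z → β * y + z * (α * x)) (*-inverseʳ β≢0)) (trans (cong (β * y +_) (*-identityˡ _)) (+-comm _ _))))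

  -- A line L through P on the curve, with a second point v on L: its points other than P are the
  -- multiples of v + t P, and form (v + t P) = form v + trace (t c) with c = ⟨v, P⟩, so the curve
  -- points among them correspond to a trace fibre, which has q elements.
  module SecantThrough {L P v : Triple} (L≢0 : NonZero L) (P≢0 : NonZero P) (P∈H : OnH P)
                       (P∈L : dot L P ≡ 0#) (v∈L : dot L v ≡ 0#) (v×P≢0 : ¬ cross v P ≡ zero³)
                       (c≢0 : ¬ dot (polar v) P ≡ 0#) where

    c : Carrier
    c = dot (polar v) P

    d : Carrier
    d = - form v

    roots : List Carrier
    roots = fibre trace d elements

    point : Carrier → Triple
    point s = v +³ scale (c ⁻¹ * s) P

    private
      open ≡-Reasoning

      P×v-nonZero : NonZero (cross P v)
      P×v-nonZero = ≢zero³⇒nonZero (v×P≢0 ∘ cross≡0-sym P v)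

      c⁻¹*[t*c]≡t : ∀ t → c ⁻¹ * (t * c) ≡ t
      c⁻¹*[t*c]≡t t = trans (cong (c ⁻¹ *_) (*-comm t c)) (trans (sym (*-assoc _ _ _)) (trans (cong (_* t) (*-inverseˡ c≢0)) (*-identityˡ t)))

      [c⁻¹*s]*c≡s : ∀ s → (c ⁻¹ * s) * c ≡ s
      [c⁻¹*s]*c≡s s = trans (*-comm _ c) (trans (sym (*-assoc _ _ _)) (trans (cong (_* s) (*-inverseʳ c≢0)) (*-identityˡ s)))

      form-line-through-P : ∀ t → form (v +³ scale t P) ≡ form v + trace (t * c)
      form-line-through-P t = begin
        form (v +³ scale t P)                              ≡⟨ form-line v P t ⟩
        form v + (t * φ t) * form P + trace (t * c)        ≡⟨ cong (λ z → form v + (t * φ t) * z + trace (t * c)) P∈H ⟩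
        form v + (t * φ t) * 0# + trace (t * c)            ≡⟨ cong (λ z → form v + z + trace (t * c)) (zeroʳ _) ⟩
        form v + 0# + trace (t * c)                        ≡⟨ cong (_+ trace (t * c)) (+-identityʳ _) ⟩
        form v + trace (t * c)                             ∎

    point∈H : ∀ {s} → trace s ≡ d → OnH (point s)
    point∈H {s} trace≡d = begin
      form (point s)                 ≡⟨ form-line-through-P (c ⁻¹ * s) ⟩
      form v + trace ((c ⁻¹ * s) * c) ≡⟨ cong (λ z → form v + trace z) ([c⁻¹*s]*c≡s s) ⟩
      form v + trace s               ≡⟨ cong (form v +_) trace≡d ⟩
      form v + - form v              ≡⟨ -‿inverseʳ _ ⟩
      0#                             ∎

    point∈L : ∀ s → dot L (point s) ≡ 0#
    point∈L s = trans (dot-line L v P (c ⁻¹ * s)) (trans (cong₂ (λ a b → a + (c ⁻¹ * s) * b) v∈L P∈L)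
                      (trans (+-identityˡ _) (zeroʳ _)))

    point-nonZero : ∀ s → NonZero (point s)
    point-nonZero s point≡0 = v×P≢0 (begin
      cross v P                  ≡⟨ cross-line v P (c ⁻¹ * s) ⟨
      cross (point s) P          ≡⟨ cong (λ X → cross X P) (pointwise point≡0) ⟩
      cross zero³ P              ≡⟨ cross-zero³ P ⟩
      zero³                      ∎)
      where
      pointwise : ∀ {X} → (proj₁ X ≡ 0# × proj₁ (proj₂ X) ≡ 0# × proj₂ (proj₂ X) ≡ 0#) → X ≡ zero³
      pointwise (refl , refl , refl) = refl

    P≁point : ∀ s → ¬ Proportional P (point s)
    P≁point s P∼point = v×P≢0 (trans (sym (cross-line v P (c ⁻¹ * s))) (cross≡0-sym P (point s) (proportional⇒cross≡0 P (point s) P∼point)))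

    point-injective : ∀ {s s′} → ¬ s ≡ s′ → ¬ Proportional (point s) (point s′)
    point-injective {s} {s′} s≢s′ point∼point = s≢s′ (sym (*-cancelˡ-≡ s′ s (⁻¹-≢0 c≢0)
      (x∙y⁻¹≈ε⇒x≈y _ _ (scale≡0⇒≡0 (≢zero³⇒nonZero v×P≢0)
        (trans (sym (cross-line-line v P (c ⁻¹ * s) (c ⁻¹ * s′))) (proportional⇒cross≡0 (point s) (point s′) point∼point))))))

    points : PointSet
    points = mkPointSet (P ∷ map point roots)
      (P≢0 ∷ All.map⁺ (All.tabulate (λ {s} _ → point-nonZero s)))
      (All.map⁺ (All.tabulate (λ {s} _ → P≁point s)) ∷ AllPairs.map⁺ (AllPairs.map point-injective (Unique.filter⁺ (λ x → trace x ≟ d) elements-unique)))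

    size-points : size points ≡ suc q
    size-points = cong suc (trans (List.length-map point roots) (length-fibre-trace d φd≡d))
      where
      φd≡d : φ d ≡ d
      φd≡d = trans (φ-homo-‿ (form v)) (cong -_ (form-self-conjugate v))

    points∈H : All OnH (pts points)
    points∈H = P∈H ∷ All.map⁺ (All.map point∈H (All.all-filter (λ x → trace x ≟ d) elements))

    points∈L : All (_onLine L) (pts points)
    points∈L = P∈L ∷ All.map⁺ (All.tabulate (λ {s} _ → point∈L s))

    points-complete : ∀ X → NonZero X → OnH X → X onLine L → X ∈ₚ points
    points-complete X X≢0 X∈H X∈L =
      let α , β , X≡ = det≡0⇒combination P v X P×v-nonZero (collinear⇒det≡0 L P v X L≢0 P∈L v∈L X∈L)
      in by-coefficient α β X≡
      where
      by-coefficient : ∀ α β → X ≡ scale α P +³ scale β v → X ∈ₚ points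
      by-coefficient α β X≡ with β ≟ 0#
      ... | yes refl = here (α , α≢0 , X≡αP)
        where
        X≡αP : X ≡ scale α P
        X≡αP = trans X≡ (combination-β≡0 α P v)
        α≢0 : ¬ α ≡ 0#
        α≢0 refl = X≢0 (from-zero (cong proj₁ X≡αP) , from-zero (cong (proj₁ ∘ proj₂) X≡αP) , from-zero (cong (proj₂ ∘ proj₂) X≡αP))
          where
          from-zero : ∀ {x y} → x ≡ 0# * y → x ≡ 0#
          from-zero x≡ = trans x≡ (zeroˡ _)
      ... | no  β≢0 = there (Any.map (λ point≡ → subst (Proportional X) point≡ X∼point) (∈.∈-map⁺ point s∈roots))
        where
        t s : Carrier
        t = α * β ⁻¹
        s = t * c
        X≡βY : X ≡ scale β (v +³ scale t P)
        X≡βY = trans X≡ (combination-β≢0 α β P v β≢0)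
        formY≡0 : form (v +³ scale t P) ≡ 0#
        formY≡0 = *-cancelˡ-≡ _ 0# (*-≢0 β≢0 (β≢0 ∘ φ≡0⇒≡0))
          (trans (sym (form-scale β _)) (trans (cong form (sym X≡βY)) (trans X∈H (sym (zeroʳ _)))))
        s∈roots : s ∈ roots
        s∈roots = ∈.∈-filter⁺ (λ x → trace x ≟ d) (∈-elements s)
          (+-inverseʳ-unique (form v) (trace s) (trans (sym (form-line-through-P t)) formY≡0))
        X∼point : Proportional X (point s)
        X∼point = β , β≢0 , trans X≡βY (cong (λ z → scale β (v +³ scale z P)) (sym (c⁻¹*[t*c]≡t t)))

    secant : IsSecant L
    secant = points , size-points , points∈H , points∈L , points-complete

  nonTangent⇒secant : ∀ L P → NonZero L → NonZero P → OnH P → dot L P ≡ 0# → ¬ cross L (polar P) ≡ zero³ → IsSecant L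
  nonTangent⇒secant L P L≢0 P≢0 P∈H P∈L L×polarP≢0 =
    let v , _ , v∈L , v×P≢0 = another-point-on-line L P L≢0 P≢0 P∈L
    in SecantThrough.secant L≢0 P≢0 P∈H P∈L v∈L v×P≢0 (c≢0 v v∈L v×P≢0)
    where
    -- Otherwise v lies on the polar of P, so L and the polar of P are both the line Pv.
    c≢0 : ∀ v → dot L v ≡ 0# → ¬ cross v P ≡ zero³ → ¬ dot (polar v) P ≡ 0#
    c≢0 v v∈L v×P≢0 c≡0 =
      let P×v-nonZero = ≢zero³⇒nonZero (v×P≢0 ∘ cross≡0-sym P v)
          a , _ , L≡ = line-through L P v L≢0 P∈L v∈L P×v-nonZero
          b , _ , polarP≡ = line-through (polar P) P v (polar-nonZero P≢0) (onH⇒on-polar P P∈H) (on-polar-sym v P c≡0) P×v-nonZero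
      in L×polarP≢0 (trans (cong₂ cross L≡ polarP≡) (cross-scale-scale≡0 a b (cross P v)))

module HermitianCurvePoints (q : ℕ) (q-primePower : IsPrimePower q) (F : FiniteField (q ℕ.* q)) where

  open FiniteField F
  open Hermitian q F
  open FiniteFieldProperties F
  open SquareOrderField q q-primePower F
  open PlaneCoordinates F
  open PointSetProperties F
  open HermitianCurve q q-primePower F
  open IntegerCoefficientSolver isCommutativeRing
  open CommutativeRing ring using (+-comm; +-identityˡ; +-identityʳ; -‿inverseˡ; *-comm; *-identityˡ; *-identityʳ; zeroˡ; zeroʳ)
  open Fibres {A = Carrier} _≟_

  norm : Carrier → Carrier
  norm a = a * φ a

  row : Carrier → List Triple
  row a = map (λ b → (1# , a , b)) (fibre trace (- norm a) elements)

  affinePoints : List Carrier → List Triple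
  affinePoints []       = []
  affinePoints (a ∷ as) = row a ++ affinePoints as

  pointAtInfinity : Triple
  pointAtInfinity = (0# , 0# , 1#)

  length-affinePoints : ∀ as → length (affinePoints as) ≡ length as ℕ.* q
  length-affinePoints []       = refl
  length-affinePoints (a ∷ as) = trans (List.length-++ (row a)) (cong₂ ℕ._+_ length-row (length-affinePoints as))
    where
    φ[-norm]≡-norm : φ (- norm a) ≡ - norm a
    φ[-norm]≡-norm = trans (φ-homo-‿ _) (cong -_ (trans (φ-homo-* a (φ a)) (trans (cong (φ a *_) (φ-involutive a)) (*-comm _ _))))
    length-row : length (row a) ≡ q
    length-row = trans (List.length-map _ (fibre trace (- norm a) elements)) (length-fibre-trace (- norm a) φ[-norm]≡-norm)

  affine∈H : ∀ {a b} → trace b ≡ - norm a → OnH (1# , a , b)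
  affine∈H {a} {b} trace≡ = begin
    b * φ 1# + φ b * 1# + a * φ a   ≡⟨ cong (λ z → b * z + φ b * 1# + a * φ a) φ-1# ⟩
    b * 1# + φ b * 1# + a * φ a     ≡⟨ cong₂ (λ u v → u + v + a * φ a) (*-identityʳ b) (*-identityʳ (φ b)) ⟩
    b + φ b + norm a                ≡⟨ cong (_+ norm a) (trans (+-comm b (φ b)) trace≡) ⟩
    - norm a + norm a               ≡⟨ -‿inverseˡ _ ⟩
    0#                              ∎
    where open ≡-Reasoning

  AffineOver : List Carrier → Triple → Set
  AffineOver as X = ∃ λ a → ∃ λ b → X ≡ (1# , a , b) × a ∈ as × trace b ≡ - norm a

  affinePoints-affine : ∀ as → All (AffineOver as) (affinePoints as)
  affinePoints-affine []       = []
  affinePoints-affine (a ∷ as) = All.++⁺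
    (All.map⁺ (All.map (λ trace≡ → a , _ , refl , here refl , trace≡) (All.all-filter (λ x → trace x ≟ - norm a) elements)))
    (All.map (λ (a′ , b , X≡ , a′∈ , trace≡) → a′ , b , X≡ , there a′∈ , trace≡) (affinePoints-affine as))

  affine-proportional⇒≡ : ∀ {a b a′ b′} → Proportional (1# , a , b) (1# , a′ , b′) → a ≡ a′ × b ≡ b′
  affine-proportional⇒≡ {a′ = a′} {b′ = b′} (c , _ , eq) =
    trans (cong (proj₁ ∘ proj₂) eq) (trans (cong (_* a′) c≡1) (*-identityˡ a′)) ,
    trans (cong (proj₂ ∘ proj₂) eq) (trans (cong (_* b′) c≡1) (*-identityˡ b′))
    where
    c≡1 : c ≡ 1#
    c≡1 = sym (trans (cong proj₁ eq) (*-identityʳ c))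

  affinePoints-distinct : ∀ {as} → Unique as → AllPairs (λ X Y → ¬ Proportional X Y) (affinePoints as)
  affinePoints-distinct {[]}     []          = []
  affinePoints-distinct {a ∷ as} (a∉as ∷ as!) = AllPairs.++⁺ row-distinct (affinePoints-distinct as!)
    (All.map⁺ (All.tabulate (λ _ → All.map (λ { (a′ , b′ , refl , a′∈as , _) X∼Y → All.lookup a∉as a′∈as (proj₁ (affine-proportional⇒≡ X∼Y)) })
                                           (affinePoints-affine as))))
    where
    row-distinct : AllPairs (λ X Y → ¬ Proportional X Y) (row a)
    row-distinct = AllPairs.map⁺ (AllPairs.map (λ b≢b′ X∼Y → b≢b′ (proj₂ (affine-proportional⇒≡ X∼Y)))
                                               (Unique.filter⁺ (λ x → trace x ≟ - norm a) elements-unique))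

  curve : PointSet
  curve = mkPointSet (pointAtInfinity ∷ affinePoints elements)
    ((λ (_ , _ , 1≡0) → 1≢0 1≡0) ∷ All.map (λ { (a , b , refl , _) (1≡0 , _) → 1≢0 1≡0 }) (affinePoints-affine elements))
    (All.map (λ { (a , b , refl , _) (c , c≢0 , eq) → c≢0 (trans (sym (*-identityʳ c)) (sym (cong proj₁ eq))) }) (affinePoints-affine elements)
      ∷ affinePoints-distinct elements-unique)

  size-curve : size curve ≡ q ℕ.^ 3 ℕ.+ 1
  size-curve = trans (cong suc (trans (length-affinePoints elements) (cong (ℕ._* q) length-elements)))
                     suc[q*q*q]≡q^3+1
    where
    suc[q*q*q]≡q^3+1 : suc (q ℕ.* q ℕ.* q) ≡ q ℕ.^ 3 ℕ.+ 1
    suc[q*q*q]≡q^3+1 = trans (cong suc (trans (ℕ.*-assoc q q q) (cong (λ z → q ℕ.* (q ℕ.* z)) (sym (ℕ.*-identityʳ q))))) (ℕ.+-comm 1 _)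

  pointAtInfinity∈H : OnH pointAtInfinity
  pointAtInfinity∈H = trans (cong₂ _+_ (cong₂ _+_ (trans (*-identityˡ _) φ-0#) (zeroʳ _)) (zeroˡ _)) (trans (+-identityʳ _) (+-identityʳ _))

  curve∈H : All OnH (pts curve)
  curve∈H = pointAtInfinity∈H ∷ All.map (λ { (a , b , refl , _ , trace≡) → affine∈H trace≡ }) (affinePoints-affine elements)

  secant-X₁≡0 : IsSecant (0# , 1# , 0#)
  secant-X₁≡0 = nonTangent⇒secant (0# , 1# , 0#) pointAtInfinity (λ (_ , 1≡0 , _) → 1≢0 1≡0) (λ (_ , _ , 1≡0) → 1≢0 1≡0)
    pointAtInfinity∈H (solve 1 (λ one → con 0ℤ :* con 0ℤ :+ one :* con 0ℤ :+ con 0ℤ :* one := con 0ℤ) refl 1#)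
    (λ eq → -‿≢0 1≢0 (trans (sym third≡-1) (cong (proj₂ ∘ proj₂) eq)))
    where
    third≡-1 : 0# * φ 0# + - (1# * φ 1#) ≡ - 1#
    third≡-1 = trans (cong₂ (λ u v → u + - v) (zeroˡ _) (trans (*-identityˡ _) φ-1#)) (+-identityˡ _)

  2-blockingSet-nonempty : ∀ B → Is2BlockingSet B → 1 ≤ size B
  2-blockingSet-nonempty _ (_ , blocks) =
    let _ , _ , P∈B , _ = blocks (0# , 1# , 0#) (λ (_ , 1≡0 , _) → 1≢0 1≡0) secant-X₁≡0
    in ∈.∈-length P∈B

  blockingSet-superset-semioval : ∀ B D → Is2BlockingSet B → All OnH (pts D) → (∀ {X} → X ∈ pts B → X ∈ pts D) →
                                  1 ≤ size D → IsSemioval D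
  blockingSet-superset-semioval B D (_ , blocks) D∈H B⊆D D-nonempty = D-nonempty , tangent
    where
    tangent : ∀ P → P ∈ pts D → ∃ λ t → NonZero t × MeetsOnlyIn D t P × (∀ t′ → NonZero t′ → MeetsOnlyIn D t′ P → Proportional t′ t)
    tangent P P∈D = polar P , polar-nonZero P≢0 , (onH⇒on-polar P P∈H , only-P) , unique
      where
      P≢0 : NonZero P
      P≢0 = All.lookup (nonzero D) P∈D
      P∈H : OnH P
      P∈H = All.lookup D∈H P∈D
      only-P : ∀ Q → Q ∈ pts D → Q onLine polar P → Proportional Q P
      only-P Q Q∈D = polar-meets-curve-only-at-pole P Q P≢0 (All.lookup (nonzero D) Q∈D) P∈H (All.lookup D∈H Q∈D)
      unique : ∀ t′ → NonZero t′ → MeetsOnlyIn D t′ P → Proportional t′ (polar P)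
      unique t′ t′≢0 (P∈t′ , only-P′) with cross (polar P) t′ ≟³ zero³
      ... | yes polar×t′≡0 = cross≡0⇒proportional (polar P) t′ (polar-nonZero P≢0) t′≢0 polar×t′≡0
      ... | no  polar×t′≢0 =
        let P₁ , P₂ , P₁∈B , P₂∈B , P₁∈t′ , P₂∈t′ , P₁≁P₂ =
              blocks t′ t′≢0 (nonTangent⇒secant t′ P t′≢0 P≢0 P∈H P∈t′ (polar×t′≢0 ∘ cross≡0-sym t′ (polar P)))
        in ⊥-elim (P₁≁P₂ (Proportional-trans (only-P′ P₁ (B⊆D P₁∈B) P₁∈t′) (Proportional-sym (only-P′ P₂ (B⊆D P₂∈B) P₂∈t′))))

open import Data.Nat using (ℕ; _≤_; _+_; _*_; _^_)
open import Data.Product using (Σ; _×_)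
open import Relation.Binary.PropositionalEquality using (_≡_)

corollary2p2 : (q : ℕ) → IsPrimePower q → (F : FiniteField (q * q)) →
    (B : Hermitian.PointSet q F) → Hermitian.Is2BlockingSet q F B →
    (k : ℕ) → Hermitian.size q F B ≤ k → k ≤ q ^ 3 + 1 →
    Σ (Hermitian.PointSet q F) (λ S → Hermitian.size q F S ≡ k × Hermitian.IsSemioval q F S)
corollary2p2 q q-primePower F B B-blocking k B≤k k≤q³+1 =
  let D , size-D , B⊆D , D-inherits = intermediate-pointSet B curve k B≤k (subst (k ≤_) (sym size-curve) k≤q³+1)
  in D , size-D , blockingSet-superset-semioval B D B-blocking (D-inherits (proj₁ B-blocking) curve∈H) B⊆D
                    (subst (1 ≤_) (sym size-D) (ℕ.≤-trans (2-blockingSet-nonempty B B-blocking) B≤k))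
  where
  open HermitianCurvePoints q q-primePower F
  open PointSetProperties F
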